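{- Let $OCl$ be the algebra generated by elements $o_{ -2k-1}$ ($k\in\mathbb{Z}_{\ge0}$) and $\varphi_i,\varphi_i^*$ ($i\in\mathbb{Z}$) with relations: the $o_{ -2k-1}$ commute with each other and with all $\varphi_i,\varphi_i^*$; $[\varphi_i,\varphi_j]_+=0$, $[\varphi_i^*,\varphi_j^*]_+=0$, $[\varphi_i,\varphi_j^*]_+=\delta_{i+j,0}$. Let $V=OCl\circ v_0$ be the module induced from a vector $v_0$ subject to $\varphi_i\circ v_0=0$ for $i>0$ and $\varphi_i^*\circ v_0=0$ for $i\ge0$ (so $V=\mathbb{C}[\varphi_0,\varphi_{ -1}^*,o_{ -1},\varphi_{ -1},\varphi_{ -2}^*,\dots]\circ v_0$, polynomial in the commuting $o$'s and exterior in $\varphi_i$ ($i\le 0$), $\varphi^*_j$ ($j\le -1$)). Let operators $s,w$ act on $V$ by $s\circ v_0=w\circ v_0=0$, $[s,w]=0$, $[s,\varphi_i]=\varphi_i$, $[s,\varphi_i^*]=-\varphi_i^*$, $[s,o_{ -2i-1}]=0$, $[w,\varphi_i]=-i\varphi_i$, $[w,\varphi_i^*]=-i\varphi_i^*$, $[w,o_{ -2i-1}]=(2i+1)o_{ -2i-1}$. Then the character $\mathrm{Tr}_V(q^wt^s)$ coincides with $F(t,q)$.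
   Context: $\mathrm{Tr}_V(q^wt^s)=\sum_{a,b}\dim V_{a,b}\,q^at^b$, where $V_{a,b}$ is the joint eigenspace of $w$ with eigenvalue $a$ and of $s$ with eigenvalue $b$. $F(t,q)$ is the following statistical sum: let $L$ be the graph with vertices $x_i,y_i$ ($i\in\mathbb{Z}$) and edges $\{x_i,y_i\},\{x_i,y_{i+1}\},\{x_{i+1},y_i\}$; a configuration is a set of vertices containing no edge; column $i$ is $\{x_i,y_i\}$ and $\Omega(\chi)$ is the set of occupied columns. A set $\Omega\subset\mathbb{Z}$ is a Dirac set if $\Omega_e=\Omega\cap\mathbb{Z}_{\ge0}$ and $\Omega_p=\mathbb{Z}_{<0}\setminus\Omega$ are finite, with charge $C(\Omega)=|\Omega_e|-|\Omega_p|$ and energy $U(\Omega)=\sum_{\alpha\in\Omega_e\cup\Omega_p}|\alpha|$. Then $F(t,q)=\sum_\chi t^{C(\Omega(\chi))}q^{U(\Omega(\chi))}$, summed over configurations $\chi$ with $\Omega(\chi)$ a Dirac set that agree with the fixed configuration $\{y_i:i\in\mathbb{Z}\}$ on all sufficiently negative columns. -}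

module Defs where

open import Level using (0ℓ)
open import Data.Nat using (ℕ; zero; suc; _+_; _*_; _≤_)
open import Data.Integer as ℤ using (ℤ; +_; -[1+_]; _-_)
open import Data.Bool using (Bool; true; false; if_then_else_)
open import Data.Product using (Σ; _×_; proj₁)
open import Data.Empty using (⊥)
open import Data.Unit using (⊤)
open import Relation.Binary.PropositionalEquality using (_≡_; refl; sym; trans)
open import Relation.Binary.Bundles using (Setoid)

sumBelow : ℕ → (ℕ → ℕ) → ℕ
sumBelow zero    f = 0
sumBelow (suc N) f = sumBelow N f + f N

count : Bool → ℕ
count true  = 1
count false = 0

-- A basis of V is given by the monomials
--   ∏_k o_{-2k-1}^{omult k} · ∏_{k : phi k} φ_{-k} · ∏_{k : phiS k} φ*_{-(k+1)} ∘ v_0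
-- (polynomial in the o's, exterior in φ_i (i ≤ 0) and φ*_j (j ≤ -1)),
-- with only finitely many factors.

record Monomial : Set where
  field
    omult    : ℕ → ℕ      -- exponent of o_{-2k-1}
    phi      : ℕ → Bool   -- whether φ_{-k}      (k ≥ 0) occurs
    phiS     : ℕ → Bool   -- whether φ*_{-(k+1)} (k ≥ 0) occurs
    bound    : ℕ
    omult-fin : ∀ k → bound ≤ k → omult k ≡ 0
    phi-fin   : ∀ k → bound ≤ k → phi k ≡ false
    phiS-fin  : ∀ k → bound ≤ k → phiS k ≡ false

open Monomial public

-- eigenvalue of w on a monomial:  w v_0 = 0, [w,o_{-2k-1}] = (2k+1) o_{-2k-1},
-- [w,φ_{-k}] = k φ_{-k},  [w,φ*_{-(k+1)}] = (k+1) φ*_{-(k+1)}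
wWeight : Monomial → ℕ
wWeight m = sumBelow (bound m) λ k →
  omult m k * (1 + 2 * k)
  + (if phi m k then k else 0)
  + (if phiS m k then suc k else 0)

-- eigenvalue of s on a monomial: s v_0 = 0, [s,φ] = φ, [s,φ*] = -φ*, [s,o] = 0
sWeight : Monomial → ℤ
sWeight m = + sumBelow (bound m) (λ k → count (phi m k))
          - + sumBelow (bound m) (λ k → count (phiS m k))

MonomialSetoid : Setoid 0ℓ 0ℓ
MonomialSetoid = record
  { Carrier = Monomial
  ; _≈_ = λ m m' → (∀ k → omult m k ≡ omult m' k)
                 × (∀ k → phi m k ≡ phi m' k)
                 × (∀ k → phiS m k ≡ phiS m' k)
  ; isEquivalence = record
    { refl  = (λ _ → refl) Data.Product., (λ _ → refl) Data.Product., (λ _ → refl)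
    ; sym   = λ { (a Data.Product., b Data.Product., c) →
                (λ k → sym (a k)) Data.Product., (λ k → sym (b k)) Data.Product., (λ k → sym (c k)) }
    ; trans = λ { (a Data.Product., b Data.Product., c) (a' Data.Product., b' Data.Product., c') →
                (λ k → trans (a k) (a' k)) Data.Product., (λ k → trans (b k) (b' k))
                  Data.Product., (λ k → trans (c k) (c' k)) }
    }
  }

-- basis of the joint eigenspace V_{a,b}  (w-eigenvalue a, s-eigenvalue b)
EigenBasis : ℕ → ℤ → Setoid 0ℓ 0ℓ
EigenBasis a b = record
  { Carrier = Σ Monomial (λ m → wWeight m ≡ a × sWeight m ≡ b)
  ; _≈_ = λ p p' → Setoid._≈_ MonomialSetoid (proj₁ p) (proj₁ p')
  ; isEquivalence = record
    { refl  = λ {p} → Setoid.refl MonomialSetoid {proj₁ p}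
    ; sym   = λ {p} {p'} → Setoid.sym MonomialSetoid {proj₁ p} {proj₁ p'}
    ; trans = λ {p} {p'} {p''} → Setoid.trans MonomialSetoid {proj₁ p} {proj₁ p'} {proj₁ p''}
    }
  }

-- Configurations on the ladder graph L.
-- A configuration contains no edge {x_i,y_i}, so each column i is
-- empty, occupied by x_i only, or by y_i only.

data Col : Set where
  emp xo yo : Col

-- no edge {x_i,y_{i+1}} and no edge {x_{i+1},y_i}
Compatible : Col → Col → Set
Compatible xo yo = ⊥
Compatible yo xo = ⊥
Compatible _  _  = ⊤

occupied : Col → Bool
occupied emp = false
occupied xo  = true
occupied yo  = true

isEmpty : Col → Bool
isEmpty emp = true
isEmpty xo  = false
isEmpty yo  = false

record Config : Set where
  field
    col   : ℤ → Col
    valid : ∀ i → Compatible (col i) (col (i ℤ.+ ℤ.1ℤ))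
    cbound : ℕ
    agree : ∀ i → i ℤ.< ℤ.- (+ cbound) → col i ≡ yo
    -- Ω_e = Ω ∩ ℤ_{≥0} finite (finiteness of Ω_p follows from 'agree')
    dirac : ∀ i → + cbound ℤ.≤ i → col i ≡ emp

open Config public

-- energy U(Ω(χ)) = Σ_{α ∈ Ω_e ∪ Ω_p} |α|
energy : Config → ℕ
energy χ = sumBelow (cbound χ) (λ k → if occupied (col χ (+ k)) then k else 0)
         + sumBelow (cbound χ) (λ k → if isEmpty (col χ -[1+ k ]) then suc k else 0)

-- charge C(Ω(χ)) = |Ω_e| - |Ω_p|
charge : Config → ℤ
charge χ = + sumBelow (cbound χ) (λ k → count (occupied (col χ (+ k))))
         - + sumBelow (cbound χ) (λ k → count (isEmpty (col χ -[1+ k ])))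

ConfigsOf : ℕ → ℤ → Setoid 0ℓ 0ℓ
ConfigsOf a b = record
  { Carrier = Σ Config (λ χ → energy χ ≡ a × charge χ ≡ b)
  ; _≈_ = λ p p' → ∀ i → col (proj₁ p) i ≡ col (proj₁ p') i
  ; isEquivalence = record
    { refl  = λ _ → refl
    ; sym   = λ e i → sym (e i)
    ; trans = λ e e' i → trans (e i) (e' i)
    }
  }

{-# OPTIONS --safe #-}
-- A basis monomial of V is a fermionic part times a polynomial in the o's.  The
-- fermionic part is a Maya diagram: φ_{-k} is an occupied column k ≥ 0 and
-- φ*_{-(k+1)} an empty column -(k+1); its w-weight is the energy U and its
-- s-weight the charge C.  By Glaisher's bijection (binary expansion of the
-- multiplicities), the o-part ∏ o_{-2k-1}^{n_k} amounts to a finite set D of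
-- positive integers with Σ D = Σ n_k (2k+1).
--
-- In a configuration an x-column only follows an x-column or an empty column, so
-- the x-columns come in runs that start right after an empty column.  Deleting the
-- first x of every run leaves a Maya diagram (x and y both count as occupied) in
-- which the holes before the deleted columns are marked; if the marked holes are
-- the j-th ones from the left for j ∈ D, the deletions lower the energy by exactly
-- Σ D, and moving the origin along with them keeps the charge.  For weight a all
-- of this happens inside a window of 2a + 1 columns on each side of the origin.
module Submission where

open import Defs
open import Data.Nat using (ℕ)
open import Data.Integer using (ℤ)
open import Function.Bundles using (Inverse)
open import Data.Nat using (zero; suc; _+_; _*_; _∸_; _≤_; _<_; z≤n; s≤s; _^_; ⌊_/2⌋; _≤?_; _<?_)
open import Data.Nat.Properties
open import Data.Nat.ListAction using (sum)
open import Data.Nat.ListAction.Properties using (sum-++)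
open import Data.Nat.Solver using (module +-*-Solver)
open import Data.Integer as ℤ using (+_; -[1+_]; -_)
import Data.Integer.Properties as ℤ
open import Data.Bool using (Bool; true; false; not; if_then_else_)
open import Data.Bool.Properties using (not-involutive)
open import Data.Product using (Σ; _×_; _,_)
open import Data.Empty using (⊥-elim)
open import Data.Unit using (⊤; tt)
open import Data.List using (List; []; _∷_; _++_; length; reverse; take; drop; map; replicate; applyUpTo; applyDownFrom)
open import Data.List.Properties
  using ( ++-assoc; map-++; map-replicate; map-applyUpTo; map-applyDownFrom; reverse-++; reverse-involutive
        ; reverse-applyUpTo; unfold-reverse; length-++; length-map; length-replicate; length-reverse; length-take
        ; length-drop; length-applyUpTo; length-applyDownFrom; take++drop≡id )
open import Relation.Binary.Bundles using (Setoid)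
open import Relation.Binary.PropositionalEquality
open import Relation.Nullary using (¬_; yes; no; contradiction)

open +-*-Solver using (solve; _:+_; _:*_; _:=_; con)
open Setoid MonomialSetoid using () renaming (_≈_ to _≈ᴹ_)

sumBelow-cong : ∀ N {f g : ℕ → ℕ} → (∀ k → f k ≡ g k) → sumBelow N f ≡ sumBelow N g
sumBelow-cong zero    f≗g = refl
sumBelow-cong (suc N) f≗g = cong₂ _+_ (sumBelow-cong N f≗g) (f≗g N)

sumBelow-+ : ∀ N (f g : ℕ → ℕ) → sumBelow N (λ k → f k + g k) ≡ sumBelow N f + sumBelow N g
sumBelow-+ zero    f g = refl
sumBelow-+ (suc N) f g rewrite sumBelow-+ N f g =
  solve 4 (λ a b c d → (a :+ b) :+ (c :+ d) := (a :+ c) :+ (b :+ d)) refl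
    (sumBelow N f) (sumBelow N g) (f N) (g N)

sumBelow-suc : ∀ n (f : ℕ → ℕ) → sumBelow (suc n) f ≡ f 0 + sumBelow n (λ k → f (suc k))
sumBelow-suc zero    f = +-comm 0 (f 0)
sumBelow-suc (suc n) f rewrite sumBelow-suc n f = +-assoc (f 0) _ (f (suc n))

sumBelow-extend : ∀ N j (f : ℕ → ℕ) → (∀ k → N ≤ k → f k ≡ 0) → sumBelow (N + j) f ≡ sumBelow N f
sumBelow-extend N zero    f f≡0 = cong (λ M → sumBelow M f) (+-identityʳ N)
sumBelow-extend N (suc j) f f≡0
  rewrite +-suc N j | sumBelow-extend N j f f≡0 | f≡0 (N + j) (m≤m+n N j) = +-identityʳ _

sumBelow-bound-irrelevant : ∀ N M (f : ℕ → ℕ) → (∀ k → N ≤ k → f k ≡ 0) → (∀ k → M ≤ k → f k ≡ 0) →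
                            sumBelow N f ≡ sumBelow M f
sumBelow-bound-irrelevant N M f f≡0ᴺ f≡0ᴹ = begin
  sumBelow N f        ≡⟨ sumBelow-extend N M f f≡0ᴺ ⟨
  sumBelow (N + M) f  ≡⟨ cong (λ K → sumBelow K f) (+-comm N M) ⟩
  sumBelow (M + N) f  ≡⟨ sumBelow-extend M N f f≡0ᴹ ⟩
  sumBelow M f        ∎
  where open ≡-Reasoning

sumBelow-default : ∀ {A : Set} N M (F : ℕ → A) d (t : ℕ → A → ℕ) → (∀ k → t k d ≡ 0) →
                   (∀ k → N ≤ k → F k ≡ d) → (∀ k → M ≤ k → F k ≡ d) →
                   sumBelow N (λ k → t k (F k)) ≡ sumBelow M (λ k → t k (F k))
sumBelow-default N M F d t t-d≡0 F≡dᴺ F≡dᴹ =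
  sumBelow-bound-irrelevant N M _ (λ k N≤k → trans (cong (t k) (F≡dᴺ k N≤k)) (t-d≡0 k))
                                  (λ k M≤k → trans (cong (t k) (F≡dᴹ k M≤k)) (t-d≡0 k))

term≤sumBelow : ∀ N (f : ℕ → ℕ) k → k < N → f k ≤ sumBelow N f
term≤sumBelow (suc N) f k k<1+N with k ≟ N
... | yes refl = m≤n+m (f k) (sumBelow N f)
... | no  k≢N  = ≤-trans (term≤sumBelow N f k (≤∧≢⇒< (≤-pred k<1+N) k≢N)) (m≤m+n _ _)

term≤sumBelow′ : ∀ N (f : ℕ → ℕ) k → (N ≤ k → f k ≡ 0) → f k ≤ sumBelow N f
term≤sumBelow′ N f k beyond with k <? N
... | yes k<N = term≤sumBelow N f k k<N
... | no  k≮N = subst (_≤ sumBelow N f) (sym (beyond (≮⇒≥ k≮N))) z≤n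

sumBelow-even+odd : ∀ N (f : ℕ → ℕ) →
  sumBelow (N + N) f ≡ sumBelow N (λ k → f (k + k)) + sumBelow N (λ k → f (suc (k + k)))
sumBelow-even+odd zero    f = refl
sumBelow-even+odd (suc N) f rewrite +-suc N N | sumBelow-even+odd N f =
  solve 4 (λ a b c d → (a :+ b) :+ c :+ d := (a :+ c) :+ (b :+ d)) refl
    (sumBelow N (λ k → f (k + k))) (sumBelow N (λ k → f (suc (k + k)))) (f (N + N)) (f (suc (N + N)))

isOdd : ℕ → Bool
isOdd zero          = false
isOdd (suc zero)    = true
isOdd (suc (suc n)) = isOdd n

data Parity : ℕ → Set where
  even : ∀ k → Parity (k + k)
  odd  : ∀ k → Parity (suc (k + k))

parity : ∀ n → Parity n
parity zero = even 0
parity (suc zero) = odd 0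
parity (suc (suc n)) with parity n
... | even k rewrite sym (+-suc k k) = even (suc k)
... | odd  k rewrite sym (+-suc k k) = odd (suc k)

isOdd-even : ∀ k → isOdd (k + k) ≡ false
isOdd-even zero    = refl
isOdd-even (suc k) rewrite +-suc k k = isOdd-even k

isOdd-odd : ∀ k → isOdd (suc (k + k)) ≡ true
isOdd-odd zero    = refl
isOdd-odd (suc k) rewrite +-suc k k = isOdd-odd k

⌊even/2⌋ : ∀ k → ⌊ k + k /2⌋ ≡ k
⌊even/2⌋ k = sym (n≡⌊n+n/2⌋ k)

⌊odd/2⌋ : ∀ k → ⌊ suc (k + k) /2⌋ ≡ k
⌊odd/2⌋ k = sym (n≡⌈n+n/2⌉ k)

isOdd+⌊/2⌋ : ∀ n → count (isOdd n) + (⌊ n /2⌋ + ⌊ n /2⌋) ≡ n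
isOdd+⌊/2⌋ n with parity n
... | even k rewrite isOdd-even k | ⌊even/2⌋ k = refl
... | odd  k rewrite isOdd-odd  k | ⌊odd/2⌋  k = refl

isOdd-bit : ∀ b x → isOdd (count b + (x + x)) ≡ b
isOdd-bit true  x = isOdd-odd x
isOdd-bit false x = isOdd-even x

⌊bit/2⌋ : ∀ b x → ⌊ count b + (x + x) /2⌋ ≡ x
⌊bit/2⌋ true  x = ⌊odd/2⌋ x
⌊bit/2⌋ false x = ⌊even/2⌋ x

⌊/2⌋<-double : ∀ m n → m < n + n → ⌊ m /2⌋ < n
⌊/2⌋<-double m n m<2n with ⌊ m /2⌋ <? n
... | yes lt = lt
... | no  ge = ⊥-elim (<⇒≱ m<2n (begin
  n + n                                       ≤⟨ +-mono-≤ (≮⇒≥ ge) (≮⇒≥ ge) ⟩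
  ⌊ m /2⌋ + ⌊ m /2⌋                           ≤⟨ m≤n+m _ (count (isOdd m)) ⟩
  count (isOdd m) + (⌊ m /2⌋ + ⌊ m /2⌋)       ≡⟨ isOdd+⌊/2⌋ m ⟩
  m                                           ∎))
  where open ≤-Reasoning

m+m≤n+n⇒m≤n : ∀ {m n} → m + m ≤ n + n → m ≤ n
m+m≤n+n⇒m≤n {m} {n} le = subst₂ _≤_ (⌊even/2⌋ m) (⌊even/2⌋ n) (⌊n/2⌋-mono le)

-- Glaisher's bijection

2^[1+d]≡2^d+2^d : ∀ d → 2 ^ suc d ≡ 2 ^ d + 2 ^ d
2^[1+d]≡2^d+2^d d = cong (_+_ (2 ^ d)) (+-identityʳ (2 ^ d))

-- With d binary digits: the part 2^i (2k+1) of a set D of distinct parts stands for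
-- 2^i copies of the odd part 2k+1.
oddParts : ℕ → (ℕ → Bool) → ℕ → ℕ
oddParts zero    D k = 0
oddParts (suc d) D k = count (D (suc (k + k))) + (oddParts d (λ n → D (n + n)) k + oddParts d (λ n → D (n + n)) k)

distinctParts : ℕ → (ℕ → ℕ) → ℕ → Bool
distinctParts zero    o n       = false
distinctParts (suc d) o zero    = false
distinctParts (suc d) o (suc n) =
  if isOdd (suc n) then isOdd (o ⌊ suc n /2⌋) else distinctParts d (λ k → ⌊ o k /2⌋) ⌊ suc n /2⌋

weightIf : (ℕ → Bool) → ℕ → ℕ
weightIf D n = if D n then n else 0

weightIf-0 : ∀ D → weightIf D 0 ≡ 0
weightIf-0 D with D 0
... | true  = refl
... | false = refl

halves-vanish : ∀ d (D : ℕ → Bool) → (∀ m → 2 ^ suc d ≤ m → D m ≡ false) → ∀ m → 2 ^ d ≤ m → D (m + m) ≡ false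
halves-vanish d D D≥2^d+1 m 2^d≤m = D≥2^d+1 (m + m) (subst (_≤ m + m) (sym (2^[1+d]≡2^d+2^d d)) (+-mono-≤ 2^d≤m 2^d≤m))

oddParts-cong : ∀ d {D D′ : ℕ → Bool} → (∀ n → D n ≡ D′ n) → ∀ k → oddParts d D k ≡ oddParts d D′ k
oddParts-cong zero    D≗D′ k = refl
oddParts-cong (suc d) D≗D′ k =
  cong₂ (λ b x → count b + (x + x)) (D≗D′ (suc (k + k))) (oddParts-cong d (λ n → D≗D′ (n + n)) k)

distinctParts-cong : ∀ d {o o′ : ℕ → ℕ} → (∀ k → o k ≡ o′ k) → ∀ n → distinctParts d o n ≡ distinctParts d o′ n
distinctParts-cong zero    o≗o′ n       = refl
distinctParts-cong (suc d) o≗o′ zero    = refl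
distinctParts-cong (suc d) o≗o′ (suc n) =
  cong₂ (if isOdd (suc n) then_else_) (cong isOdd (o≗o′ ⌊ suc n /2⌋))
        (distinctParts-cong d (λ k → cong ⌊_/2⌋ (o≗o′ k)) ⌊ suc n /2⌋)

distinctParts-zero : ∀ d o → distinctParts d o 0 ≡ false
distinctParts-zero zero    o = refl
distinctParts-zero (suc d) o = refl

distinctParts-odd : ∀ d o k → distinctParts (suc d) o (suc (k + k)) ≡ isOdd (o k)
distinctParts-odd d o k rewrite isOdd-odd k | ⌊odd/2⌋ k = refl

distinctParts-even : ∀ d o n → distinctParts (suc d) o (n + n) ≡ distinctParts d (λ k → ⌊ o k /2⌋) n
distinctParts-even d o zero    = sym (distinctParts-zero d _)
distinctParts-even d o (suc n) rewrite +-suc n n | isOdd-even n | ⌊even/2⌋ n = refl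

oddParts-distinctParts : ∀ d (o : ℕ → ℕ) k → o k < 2 ^ d → oddParts d (distinctParts d o) k ≡ o k
oddParts-distinctParts zero    o k o<1 = sym (n<1⇒n≡0 o<1)
oddParts-distinctParts (suc d) o k o<2^d+1 = begin
  count (distinctParts (suc d) o (suc (k + k))) + (h + h)   ≡⟨ cong₂ (λ b x → count b + (x + x)) (distinctParts-odd d o k) IH ⟩
  count (isOdd (o k)) + (⌊ o k /2⌋ + ⌊ o k /2⌋)              ≡⟨ isOdd+⌊/2⌋ (o k) ⟩
  o k                                                        ∎
  where
  open ≡-Reasoning
  h : ℕ
  h = oddParts d (λ n → distinctParts (suc d) o (n + n)) k
  IH : h ≡ ⌊ o k /2⌋
  IH = trans (oddParts-cong d (distinctParts-even d o) k)
             (oddParts-distinctParts d (λ j → ⌊ o j /2⌋) k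
               (⌊/2⌋<-double (o k) (2 ^ d) (subst (o k <_) (2^[1+d]≡2^d+2^d d) o<2^d+1)))

distinctParts-oddParts : ∀ d (D : ℕ → Bool) → D 0 ≡ false → (∀ m → 2 ^ d ≤ m → D m ≡ false) →
                         ∀ n → distinctParts d (oddParts d D) n ≡ D n
distinctParts-oddParts zero    D D0 D≥1 zero    = sym D0
distinctParts-oddParts zero    D D0 D≥1 (suc n) = sym (D≥1 (suc n) (s≤s z≤n))
distinctParts-oddParts (suc d) D D0 D≥2^d+1 n with parity n
... | odd k rewrite distinctParts-odd d (oddParts (suc d) D) k =
  isOdd-bit (D (suc (k + k))) (oddParts d (λ m → D (m + m)) k)
... | even k = begin
  distinctParts (suc d) (oddParts (suc d) D) (k + k)                ≡⟨ distinctParts-even d (oddParts (suc d) D) k ⟩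
  distinctParts d (λ j → ⌊ oddParts (suc d) D j /2⌋) k              ≡⟨ distinctParts-cong d (λ j → ⌊bit/2⌋ (D (suc (j + j))) _) k ⟩
  distinctParts d (oddParts d (λ m → D (m + m))) k                  ≡⟨ distinctParts-oddParts d (λ m → D (m + m)) D0 (halves-vanish d D D≥2^d+1) k ⟩
  D (k + k)                                                          ∎
  where open ≡-Reasoning

oddParts-weight : ∀ d R (D : ℕ → Bool) → (∀ m → R ≤ m → D m ≡ false) → (∀ m → 2 ^ d ≤ m → D m ≡ false) →
                  sumBelow R (λ k → oddParts d D k * suc (k + k)) ≡ sumBelow (R + R) (weightIf D)
oddParts-weight zero R D _ D≥1 = trans (sumBelow-bound-irrelevant R 0 _ (λ _ _ → refl) (λ _ _ → refl))
                                       (sumBelow-bound-irrelevant 0 (R + R) (weightIf D) (λ k _ → no-weight k) (λ k _ → no-weight k))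
  where
  no-weight : ∀ k → weightIf D k ≡ 0
  no-weight zero    = weightIf-0 D
  no-weight (suc k) rewrite D≥1 (suc k) (s≤s z≤n) = refl
oddParts-weight (suc d) R D D≥R D≥2^d+1 = begin
  sumBelow R (λ k → oddParts (suc d) D k * suc (k + k))           ≡⟨ sumBelow-cong R term ⟩
  sumBelow R (λ k → weightIf D (suc (k + k)) + (g k + g k))        ≡⟨ sumBelow-+ R _ _ ⟩
  Odd + sumBelow R (λ k → g k + g k)                              ≡⟨ cong (_+_ Odd) (sumBelow-+ R g g) ⟩
  Odd + (sumBelow R g + sumBelow R g)                             ≡⟨ cong (λ x → Odd + (x + x)) IH ⟩
  Odd + (sumBelow R (weightIf D′) + sumBelow R (weightIf D′))     ≡⟨ cong (_+_ Odd) (sumBelow-+ R (weightIf D′) (weightIf D′)) ⟨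
  Odd + sumBelow R (λ k → weightIf D′ k + weightIf D′ k)          ≡⟨ cong (_+_ Odd) (sumBelow-cong R double) ⟩
  Odd + sumBelow R (λ k → weightIf D (k + k))                     ≡⟨ +-comm Odd _ ⟩
  sumBelow R (λ k → weightIf D (k + k)) + Odd                     ≡⟨ sumBelow-even+odd R (weightIf D) ⟨
  sumBelow (R + R) (weightIf D)                                   ∎
  where
  open ≡-Reasoning
  D′ : ℕ → Bool
  D′ n = D (n + n)
  g : ℕ → ℕ
  g k = oddParts d D′ k * suc (k + k)
  Odd : ℕ
  Odd = sumBelow R (λ k → weightIf D (suc (k + k)))
  D′≥R : ∀ m → R ≤ m → D′ m ≡ false
  D′≥R m R≤m = D≥R (m + m) (≤-trans R≤m (m≤m+n m m))
  IH : sumBelow R g ≡ sumBelow R (weightIf D′)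
  IH = trans (oddParts-weight d R D′ D′≥R (halves-vanish d D D≥2^d+1))
             (sumBelow-extend R R (weightIf D′) (λ k R≤k → cong (λ b → if b then k else 0) (D′≥R k R≤k)))
  term : ∀ k → oddParts (suc d) D k * suc (k + k) ≡ weightIf D (suc (k + k)) + (g k + g k)
  term k with D (suc (k + k))
  ... | true  = solve 2 (λ x s → (con 1 :+ (x :+ x)) :* s := s :+ (x :* s :+ x :* s)) refl (oddParts d D′ k) (suc (k + k))
  ... | false = solve 2 (λ x s → (con 0 :+ (x :+ x)) :* s := con 0 :+ (x :* s :+ x :* s)) refl (oddParts d D′ k) (suc (k + k))
  double : ∀ k → weightIf D′ k + weightIf D′ k ≡ weightIf D (k + k)
  double k with D (k + k)
  ... | true  = refl
  ... | false = refl

oddParts-vanish : ∀ d (D : ℕ → Bool) R → (∀ m → R ≤ m → D m ≡ false) → ∀ k → R ≤ suc (k + k) → oddParts d D k ≡ 0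
oddParts-vanish zero    D R D≥R k R≤2k+1 = refl
oddParts-vanish (suc d) D R D≥R k R≤2k+1
  rewrite D≥R (suc (k + k)) R≤2k+1
        | oddParts-vanish d (λ n → D (n + n)) R (λ m R≤m → D≥R (m + m) (≤-trans R≤m (m≤m+n m m))) k R≤2k+1 = refl

distinctParts-bound : ∀ d o n → distinctParts d o n ≡ true → Σ ℕ λ k → n ≤ o k * suc (k + k)
distinctParts-bound zero    o n ()
distinctParts-bound (suc d) o n Dn with parity n
... | odd k = k , odd≤ (o k) (trans (sym (distinctParts-odd d o k)) Dn)
  where
  odd≤ : ∀ x → isOdd x ≡ true → suc (k + k) ≤ x * suc (k + k)
  odd≤ (suc x) _ = m≤m+n _ _
... | even k with distinctParts-bound d (λ j → ⌊ o j /2⌋) k (trans (sym (distinctParts-even d o k)) Dn)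
... | j , k≤ = j , (begin
  k + k                                             ≤⟨ +-mono-≤ k≤ k≤ ⟩
  ⌊ o j /2⌋ * suc (j + j) + ⌊ o j /2⌋ * suc (j + j) ≡⟨ *-distribʳ-+ (suc (j + j)) (⌊ o j /2⌋) (⌊ o j /2⌋) ⟨
  (⌊ o j /2⌋ + ⌊ o j /2⌋) * suc (j + j)             ≤⟨ *-monoˡ-≤ (suc (j + j)) (≤-trans (m≤n+m _ (count (isOdd (o j)))) (≤-reflexive (isOdd+⌊/2⌋ (o j)))) ⟩
  o j * suc (j + j)                                 ∎)
  where open ≤-Reasoning

n<2^n : ∀ n → n < 2 ^ n
n<2^n zero    = s≤s z≤n
n<2^n (suc n) = begin-strict
  suc n            ≤⟨ n<2^n n ⟩
  2 ^ n            <⟨ m<m+n (2 ^ n) (≤-trans (s≤s z≤n) (n<2^n n)) ⟩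
  2 ^ n + 2 ^ n    ≡⟨ 2^[1+d]≡2^d+2^d n ⟨
  2 ^ suc n        ∎
  where open ≤-Reasoning

private
  variable
    A : Set

lookupOr : A → List A → ℕ → A
lookupOr d []       n       = d
lookupOr d (x ∷ xs) zero    = x
lookupOr d (x ∷ xs) (suc n) = lookupOr d xs n

lookupOr-beyond : ∀ (d : A) xs n → length xs ≤ n → lookupOr d xs n ≡ d
lookupOr-beyond d []       n       _       = refl
lookupOr-beyond d (x ∷ xs) (suc n) (s≤s ≤n) = lookupOr-beyond d xs n ≤n

lookupOr-++-replicate : ∀ (d : A) xs j n → lookupOr d (xs ++ replicate j d) n ≡ lookupOr d xs n
lookupOr-++-replicate d []       zero    n       = refl
lookupOr-++-replicate d []       (suc j) zero    = refl
lookupOr-++-replicate d []       (suc j) (suc n) = lookupOr-++-replicate d [] j n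
lookupOr-++-replicate d (x ∷ xs) j       zero    = refl
lookupOr-++-replicate d (x ∷ xs) j       (suc n) = lookupOr-++-replicate d xs j n

lookupOr-applyUpTo : ∀ (d : A) F n → (∀ k → n ≤ k → F k ≡ d) → ∀ k → lookupOr d (applyUpTo F n) k ≡ F k
lookupOr-applyUpTo d F zero    F≡d k       = sym (F≡d k z≤n)
lookupOr-applyUpTo d F (suc n) F≡d zero    = refl
lookupOr-applyUpTo d F (suc n) F≡d (suc k) = lookupOr-applyUpTo d (λ j → F (suc j)) n (λ j n≤j → F≡d (suc j) (s≤s n≤j)) k

applyUpTo-lookupOr : ∀ (d : A) xs → applyUpTo (lookupOr d xs) (length xs) ≡ xs
applyUpTo-lookupOr d []       = refl
applyUpTo-lookupOr d (x ∷ xs) = cong (x ∷_) (applyUpTo-lookupOr d xs)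

reverse-applyDownFrom : ∀ (F : ℕ → A) n → reverse (applyDownFrom F n) ≡ applyUpTo F n
reverse-applyDownFrom F n = trans (cong reverse (sym (reverse-applyUpTo F n))) (reverse-involutive (applyUpTo F n))

applyDownFrom-lookupOr : ∀ (d : A) xs → applyDownFrom (lookupOr d xs) (length xs) ≡ reverse xs
applyDownFrom-lookupOr d xs = begin
  applyDownFrom (lookupOr d xs) (length xs)          ≡⟨ reverse-applyUpTo (lookupOr d xs) (length xs) ⟨
  reverse (applyUpTo (lookupOr d xs) (length xs))    ≡⟨ cong reverse (applyUpTo-lookupOr d xs) ⟩
  reverse xs                                         ∎
  where open ≡-Reasoning

applyUpTo-cong : ∀ {F G : ℕ → A} → (∀ k → F k ≡ G k) → ∀ n → applyUpTo F n ≡ applyUpTo G n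
applyUpTo-cong F≗G zero    = refl
applyUpTo-cong F≗G (suc n) = cong₂ _∷_ (F≗G 0) (applyUpTo-cong (λ k → F≗G (suc k)) n)

applyDownFrom-cong : ∀ {F G : ℕ → A} → (∀ k → F k ≡ G k) → ∀ n → applyDownFrom F n ≡ applyDownFrom G n
applyDownFrom-cong F≗G zero    = refl
applyDownFrom-cong F≗G (suc n) = cong₂ _∷_ (F≗G n) (applyDownFrom-cong F≗G n)

applyUpTo-+ : ∀ (F : ℕ → A) m n → applyUpTo F (m + n) ≡ applyUpTo F m ++ applyUpTo (λ k → F (m + k)) n
applyUpTo-+ F zero    n = refl
applyUpTo-+ F (suc m) n = cong (F 0 ∷_) (applyUpTo-+ (λ k → F (suc k)) m n)

applyUpTo-const : ∀ (d : A) F → (∀ k → F k ≡ d) → ∀ n → applyUpTo F n ≡ replicate n d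
applyUpTo-const d F F≡d zero    = refl
applyUpTo-const d F F≡d (suc n) = cong₂ _∷_ (F≡d 0) (applyUpTo-const d (λ k → F (suc k)) (λ k → F≡d (suc k)) n)

applyDownFrom-+ : ∀ (d : A) F a → (∀ n → a ≤ n → F n ≡ d) → ∀ j → applyDownFrom F (j + a) ≡ replicate j d ++ applyDownFrom F a
applyDownFrom-+ d F a F≡d zero    = refl
applyDownFrom-+ d F a F≡d (suc j) = cong₂ _∷_ (F≡d (j + a) (m≤n+m a j)) (applyDownFrom-+ d F a F≡d j)

applyDownFrom-lookupOr-pad : ∀ (d : A) xs j → applyDownFrom (lookupOr d xs) (j + length xs) ≡ replicate j d ++ reverse xs
applyDownFrom-lookupOr-pad d xs j =
  trans (applyDownFrom-+ d (lookupOr d xs) (length xs) (lookupOr-beyond d xs) j)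
        (cong (replicate j d ++_) (applyDownFrom-lookupOr d xs))

take-++-length : ∀ (u v : List A) → take (length u) (u ++ v) ≡ u
take-++-length []      v = refl
take-++-length (x ∷ u) v = cong (x ∷_) (take-++-length u v)

drop-++-length : ∀ (u v : List A) → drop (length u) (u ++ v) ≡ v
drop-++-length []      v = refl
drop-++-length (x ∷ u) v = drop-++-length u v

take-replicate-++ : ∀ k o (x : A) c → take (k + o) (replicate k x ++ c) ≡ replicate k x ++ take o c
take-replicate-++ zero    o x c = refl
take-replicate-++ (suc k) o x c = cong (x ∷_) (take-replicate-++ k o x c)

drop-replicate-++ : ∀ k o (x : A) c → drop (k + o) (replicate k x ++ c) ≡ drop o c
drop-replicate-++ zero    o x c = refl
drop-replicate-++ (suc k) o x c = drop-replicate-++ k o x c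

replicate-+ : ∀ i j (x : A) → replicate (i + j) x ≡ replicate i x ++ replicate j x
replicate-+ zero    j x = refl
replicate-+ (suc i) j x = cong (x ∷_) (replicate-+ i j x)

reverse-replicate : ∀ n (x : A) → reverse (replicate n x) ≡ replicate n x
reverse-replicate n x = begin
  reverse (replicate n x)                   ≡⟨ cong reverse (applyUpTo-const x (λ _ → x) (λ _ → refl) n) ⟨
  reverse (applyUpTo (λ _ → x) n)           ≡⟨ reverse-applyUpTo (λ _ → x) n ⟩
  applyDownFrom (λ _ → x) n                 ≡⟨ applyDownFrom-const n ⟩
  replicate n x                             ∎
  where
  open ≡-Reasoning
  applyDownFrom-const : ∀ n → applyDownFrom (λ _ → x) n ≡ replicate n x
  applyDownFrom-const zero    = refl
  applyDownFrom-const (suc n) = cong (x ∷_) (applyDownFrom-const n)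

lookupOr-reverse-take-pad : ∀ (d : A) k o c n → lookupOr d (reverse (take (k + o) (replicate k d ++ c))) n ≡ lookupOr d (reverse (take o c)) n
lookupOr-reverse-take-pad d k o c n = begin
  lookupOr d (reverse (take (k + o) (replicate k d ++ c))) n   ≡⟨ cong (λ L → lookupOr d (reverse L) n) (take-replicate-++ k o d c) ⟩
  lookupOr d (reverse (replicate k d ++ take o c)) n           ≡⟨ cong (λ L → lookupOr d L n) (reverse-++ (replicate k d) (take o c)) ⟩
  lookupOr d (reverse (take o c) ++ reverse (replicate k d)) n ≡⟨ cong (λ L → lookupOr d (reverse (take o c) ++ L) n) (reverse-replicate k d) ⟩
  lookupOr d (reverse (take o c) ++ replicate k d) n           ≡⟨ lookupOr-++-replicate d (reverse (take o c)) k n ⟩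
  lookupOr d (reverse (take o c)) n                            ∎
  where open ≡-Reasoning

length-take-≤ : ∀ o (c : List A) → o ≤ length c → length (take o c) ≡ o
length-take-≤ o c o≤ = trans (length-take o c) (m≤n⇒m⊓n≡m o≤)

window : (ℕ → A) → ℕ → (ℕ → A) → ℕ → List A
window L m R n = applyDownFrom L m ++ applyUpTo R n

length-window : ∀ (L : ℕ → A) m R n → length (window L m R n) ≡ m + n
length-window L m R n = trans (length-++ (applyDownFrom L m)) (cong₂ _+_ (length-applyDownFrom L m) (length-applyUpTo R n))

map-window : ∀ {B : Set} (g : A → B) L m R n → map g (window L m R n) ≡ window (λ k → g (L k)) m (λ k → g (R k)) n
map-window g L m R n = trans (map-++ g (applyDownFrom L m) (applyUpTo R n))
                             (cong₂ _++_ (map-applyDownFrom L g m) (map-applyUpTo R g n))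

take-window : ∀ (L : ℕ → A) m R n → take m (window L m R n) ≡ applyDownFrom L m
take-window L m R n = trans (cong (λ j → take j (window L m R n)) (sym (length-applyDownFrom L m))) (take-++-length (applyDownFrom L m) (applyUpTo R n))

drop-window : ∀ (L : ℕ → A) m R n → drop m (window L m R n) ≡ applyUpTo R n
drop-window L m R n = trans (cong (λ j → drop j (window L m R n)) (sym (length-applyDownFrom L m))) (drop-++-length (applyDownFrom L m) (applyUpTo R n))

trues falses : List Bool → ℕ
trues w  = sum (map count w)
falses w = trues (map not w)

trues-++ : ∀ u v → trues (u ++ v) ≡ trues u + trues v
trues-++ u v = trans (cong sum (map-++ count u v)) (sum-++ (map count u) (map count v))

falses-++ : ∀ u v → falses (u ++ v) ≡ falses u + falses v
falses-++ u v = trans (cong trues (map-++ not u v)) (trues-++ (map not u) (map not v))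

trues+falses : ∀ w → trues w + falses w ≡ length w
trues+falses []          = refl
trues+falses (true ∷ w)  = cong suc (trues+falses w)
trues+falses (false ∷ w) = trans (+-suc (trues w) (falses w)) (cong suc (trues+falses w))

falses≤length : ∀ w → falses w ≤ length w
falses≤length w = ≤-trans (m≤n+m (falses w) (trues w)) (≤-reflexive (trues+falses w))

falses-replicate : ∀ n → falses (replicate n false) ≡ n
falses-replicate zero    = refl
falses-replicate (suc n) = cong suc (falses-replicate n)

falses-replicate-true : ∀ k w → falses (replicate k true ++ w) ≡ falses w
falses-replicate-true zero    w = refl
falses-replicate-true (suc k) w = falses-replicate-true k w

trues-applyUpTo : ∀ F n → trues (applyUpTo F n) ≡ sumBelow n (λ k → count (F k))
trues-applyUpTo F zero    = refl
trues-applyUpTo F (suc n) = trans (cong (_+_ (count (F 0))) (trues-applyUpTo (λ k → F (suc k)) n))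
                                  (sym (sumBelow-suc n (λ k → count (F k))))

falses-applyDownFrom : ∀ F n → falses (applyDownFrom F n) ≡ sumBelow n (λ k → count (not (F k)))
falses-applyDownFrom F zero    = refl
falses-applyDownFrom F (suc n) = trans (cong (_+_ (count (not (F n)))) (falses-applyDownFrom F n))
                                       (+-comm (count (not (F n))) _)

neg : ℕ → ℤ
neg n = - (+ n)

-- i + 1, by cases so that it computes on -[1+ j ].
next : ℤ → ℤ
next (+ s)            = + suc s
next -[1+ zero ]      = + 0
next -[1+ suc j ]     = -[1+ j ]

cellEnergy : Bool → ℤ → ℕ
cellEnergy b (+ s)      = if b then s else 0
cellEnergy b -[1+ j ]   = if b then 0 else suc j

wordEnergy : List Bool → ℤ → ℕ
wordEnergy []      i = 0
wordEnergy (b ∷ w) i = cellEnergy b i + wordEnergy w (next i)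

next-neg : ∀ j → next (neg (suc j)) ≡ neg j
next-neg zero    = refl
next-neg (suc j) = refl

wordEnergy-particle : ∀ w j → wordEnergy (true ∷ w) (neg (suc j)) ≡ wordEnergy w (neg j)
wordEnergy-particle w j = cong (wordEnergy w) (next-neg j)

cellEnergy-swap : ∀ b i → cellEnergy b i + cellEnergy true (next i) ≡ cellEnergy true i + cellEnergy b (next i) + count (not b)
cellEnergy-swap true  (+ s)            = sym (+-identityʳ _)
cellEnergy-swap false (+ s)            = trans (+-comm 0 (suc s)) (sym (+-comm (s + 0) 1))
cellEnergy-swap true  -[1+ zero ]      = refl
cellEnergy-swap false -[1+ zero ]      = refl
cellEnergy-swap true  -[1+ suc j ]     = refl
cellEnergy-swap false -[1+ suc j ]     = cong suc (trans (cong suc (+-identityʳ j)) (+-comm 1 j))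

wordEnergy-bubble : ∀ u v i → wordEnergy (u ++ true ∷ v) i ≡ wordEnergy (true ∷ u ++ v) i + falses u
wordEnergy-bubble []      v i = sym (+-identityʳ _)
wordEnergy-bubble (b ∷ u) v i = begin
  cellEnergy b i + wordEnergy (u ++ true ∷ v) (next i)                 ≡⟨ cong (_+_ (cellEnergy b i)) (wordEnergy-bubble u v (next i)) ⟩
  cellEnergy b i + ((cellEnergy true (next i) + rest) + falses u)      ≡⟨ solve 4 (λ a b c d → a :+ ((b :+ c) :+ d) := (a :+ b) :+ (c :+ d)) refl
                                                                              (cellEnergy b i) (cellEnergy true (next i)) rest (falses u) ⟩
  (cellEnergy b i + cellEnergy true (next i)) + (rest + falses u)      ≡⟨ cong (_+ (rest + falses u)) (cellEnergy-swap b i) ⟩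
  (cellEnergy true i + cellEnergy b (next i) + count (not b)) + (rest + falses u)
                                                                       ≡⟨ solve 5 (λ a b c d e → (a :+ b :+ c) :+ (d :+ e) := (a :+ (b :+ d)) :+ (c :+ e)) refl
                                                                              (cellEnergy true i) (cellEnergy b (next i)) (count (not b)) rest (falses u) ⟩
  (cellEnergy true i + (cellEnergy b (next i) + rest)) + falses (b ∷ u) ∎
  where
  open ≡-Reasoning
  rest : ℕ
  rest = wordEnergy (u ++ v) (next (next i))

wordEnergy-applyDownFrom : ∀ (L : ℕ → Bool) n rest →
  wordEnergy (applyDownFrom L n ++ rest) (neg n) ≡ sumBelow n (λ k → if L k then 0 else suc k) + wordEnergy rest (+ 0)
wordEnergy-applyDownFrom L zero    rest = refl
wordEnergy-applyDownFrom L (suc n) rest = begin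
  cellEnergy (L n) -[1+ n ] + wordEnergy (applyDownFrom L n ++ rest) (next (neg (suc n)))
    ≡⟨ cong (λ i → cellEnergy (L n) -[1+ n ] + wordEnergy (applyDownFrom L n ++ rest) i) (next-neg n) ⟩
  cellEnergy (L n) -[1+ n ] + wordEnergy (applyDownFrom L n ++ rest) (neg n)
    ≡⟨ cong (_+_ (cellEnergy (L n) -[1+ n ])) (wordEnergy-applyDownFrom L n rest) ⟩
  cellEnergy (L n) -[1+ n ] + (sumBelow n (λ k → if L k then 0 else suc k) + wordEnergy rest (+ 0))
    ≡⟨ solve 3 (λ a b c → a :+ (b :+ c) := (b :+ a) :+ c) refl
         (cellEnergy (L n) -[1+ n ]) (sumBelow n (λ k → if L k then 0 else suc k)) (wordEnergy rest (+ 0)) ⟩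
  (sumBelow n (λ k → if L k then 0 else suc k) + cellEnergy (L n) -[1+ n ]) + wordEnergy rest (+ 0) ∎
  where open ≡-Reasoning

wordEnergy-applyUpTo : ∀ (R : ℕ → Bool) s n → wordEnergy (applyUpTo R n) (+ s) ≡ sumBelow n (λ k → if R k then s + k else 0)
wordEnergy-applyUpTo R s zero    = refl
wordEnergy-applyUpTo R s (suc n) = begin
  cellEnergy (R 0) (+ s) + wordEnergy (applyUpTo (λ k → R (suc k)) n) (+ suc s)
    ≡⟨ cong₂ _+_ (cong (if R 0 then_else 0) (sym (+-identityʳ s))) (wordEnergy-applyUpTo (λ k → R (suc k)) (suc s) n) ⟩
  (if R 0 then s + 0 else 0) + sumBelow n (λ k → if R (suc k) then suc s + k else 0)
    ≡⟨ cong (_+_ (if R 0 then s + 0 else 0)) (sumBelow-cong n (λ k → cong (if R (suc k) then_else 0) (sym (+-suc s k)))) ⟩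
  (if R 0 then s + 0 else 0) + sumBelow n (λ k → if R (suc k) then s + suc k else 0)
    ≡⟨ sumBelow-suc n (λ k → if R k then s + k else 0) ⟨
  sumBelow (suc n) (λ k → if R k then s + k else 0) ∎
  where open ≡-Reasoning

wordEnergy-window : ∀ (L : ℕ → Bool) m R n →
  wordEnergy (window L m R n) (neg m) ≡ sumBelow m (λ k → if L k then 0 else suc k) + sumBelow n (weightIf R)
wordEnergy-window L m R n =
  trans (wordEnergy-applyDownFrom L m (applyUpTo R n))
        (cong (_+_ (sumBelow m (λ k → if L k then 0 else suc k))) (wordEnergy-applyUpTo R 0 n))

trues-window : ∀ (L : ℕ → Bool) m R n →
  sumBelow n (λ k → count (R k)) + m ≡ trues (window L m R n) + sumBelow m (λ k → count (not (L k)))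
trues-window L m R n = begin
  sumBelow n (λ k → count (R k)) + m
    ≡⟨ cong₂ _+_ (sym (trues-applyUpTo R n)) (sym (trans (trues+falses left) (length-applyDownFrom L m))) ⟩
  trues (applyUpTo R n) + (trues left + falses left)
    ≡⟨ solve 3 (λ a b c → a :+ (b :+ c) := (b :+ a) :+ c) refl (trues (applyUpTo R n)) (trues left) (falses left) ⟩
  (trues left + trues (applyUpTo R n)) + falses left
    ≡⟨ cong₂ _+_ (sym (trues-++ left (applyUpTo R n))) (falses-applyDownFrom L m) ⟩
  trues (window L m R n) + sumBelow m (λ k → count (not (L k))) ∎
  where
  open ≡-Reasoning
  left : List Bool
  left = applyDownFrom L m

-- Configurations as marked Maya diagrams

ValidAfter : Col → List Col → Set
ValidAfter c []       = ⊤
ValidAfter c (c′ ∷ w) = Compatible c c′ × ValidAfter c′ w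

Compatible-emp : ∀ c → Compatible c emp
Compatible-emp emp = tt
Compatible-emp xo  = tt
Compatible-emp yo  = tt

data Letter : Set where
  particle hole marked : Letter

data Species : Set where
  X Y : Species

particleCol : Species → Col
particleCol X = xo
particleCol Y = yo

-- In decode s f the particles are s-columns up to the next hole; a marked hole is an
-- empty column followed by an x-column that is not a particle but starts an x-run.
decode : Species → List Letter → List Col
decode s []             = []
decode s (particle ∷ f) = particleCol s ∷ decode s f
decode s (hole ∷ f)     = emp ∷ decode Y f
decode s (marked ∷ f)   = emp ∷ xo ∷ decode X f

encode : List Col → List Letter
encode []              = []
encode (yo ∷ w)        = particle ∷ encode w
encode (xo ∷ w)        = particle ∷ encode w
encode (emp ∷ [])      = hole ∷ []
encode (emp ∷ emp ∷ w) = hole ∷ encode (emp ∷ w)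
encode (emp ∷ yo ∷ w)  = hole ∷ encode (yo ∷ w)
encode (emp ∷ xo ∷ w)  = marked ∷ encode w

encode-decode : ∀ s f → encode (decode s f) ≡ f
encode-decode s []             = refl
encode-decode X (particle ∷ f) = cong (particle ∷_) (encode-decode X f)
encode-decode Y (particle ∷ f) = cong (particle ∷_) (encode-decode Y f)
encode-decode s (hole ∷ f)     = trans (encode-hole f) (cong (hole ∷_) (encode-decode Y f))
  where
  encode-hole : ∀ f → encode (emp ∷ decode Y f) ≡ hole ∷ encode (decode Y f)
  encode-hole []             = refl
  encode-hole (particle ∷ f) = refl
  encode-hole (hole ∷ f)     = refl
  encode-hole (marked ∷ f)   = refl
encode-decode s (marked ∷ f)   = cong (marked ∷_) (encode-decode X f)

mutual
  decode-encode : ∀ s w → ValidAfter (particleCol s) w → decode s (encode w) ≡ w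
  decode-encode s []        _         = refl
  decode-encode X (yo ∷ w)  (() , _)
  decode-encode Y (yo ∷ w)  (_ , valid) = cong (yo ∷_) (decode-encode Y w valid)
  decode-encode X (xo ∷ w)  (_ , valid) = cong (xo ∷_) (decode-encode X w valid)
  decode-encode Y (xo ∷ w)  (() , _)
  decode-encode s (emp ∷ w) (_ , valid) = decode-encode-emp s w valid

  decode-encode-emp : ∀ s w → ValidAfter emp w → decode s (encode (emp ∷ w)) ≡ emp ∷ w
  decode-encode-emp s []        _           = refl
  decode-encode-emp s (emp ∷ w) (_ , valid) = cong (emp ∷_) (decode-encode-emp Y w valid)
  decode-encode-emp s (yo ∷ w)  (_ , valid) = cong (λ w′ → emp ∷ yo ∷ w′) (decode-encode Y w valid)
  decode-encode-emp s (xo ∷ w)  (_ , valid) = cong (λ w′ → emp ∷ xo ∷ w′) (decode-encode X w valid)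

decode-valid : ∀ s c f → Compatible c (particleCol s) → ValidAfter c (decode s f)
decode-valid s c []             _    = tt
decode-valid X c (particle ∷ f) c~s  = c~s , decode-valid X xo f tt
decode-valid Y c (particle ∷ f) c~s  = c~s , decode-valid Y yo f tt
decode-valid s c (hole ∷ f)     _    = Compatible-emp c , decode-valid Y emp f tt
decode-valid s c (marked ∷ f)   _    = Compatible-emp c , tt , decode-valid X xo f tt

#marked : List Letter → ℕ
#marked []             = 0
#marked (particle ∷ f) = #marked f
#marked (hole ∷ f)     = #marked f
#marked (marked ∷ f)   = suc (#marked f)

isParticle : Letter → Bool
isParticle particle = true
isParticle hole     = false
isParticle marked   = false

plain : List Letter → List Bool
plain = map isParticle

expand : List Letter → List Bool
expand []             = []
expand (particle ∷ f) = true ∷ expand f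
expand (hole ∷ f)     = false ∷ expand f
expand (marked ∷ f)   = false ∷ true ∷ expand f

occupied-decode : ∀ s f → map occupied (decode s f) ≡ expand f
occupied-decode s []             = refl
occupied-decode X (particle ∷ f) = cong (true ∷_) (occupied-decode X f)
occupied-decode Y (particle ∷ f) = cong (true ∷_) (occupied-decode Y f)
occupied-decode s (hole ∷ f)     = cong (false ∷_) (occupied-decode Y f)
occupied-decode s (marked ∷ f)   = cong (λ w → false ∷ true ∷ w) (occupied-decode X f)

length-decode : ∀ s f → length (decode s f) ≡ length f + #marked f
length-decode s []             = refl
length-decode s (particle ∷ f) = cong suc (length-decode s f)
length-decode s (hole ∷ f)     = cong suc (length-decode Y f)
length-decode s (marked ∷ f)   = cong suc (trans (cong suc (length-decode X f)) (sym (+-suc (length f) (#marked f))))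

#marked≤length : ∀ f → #marked f ≤ length f
#marked≤length []             = z≤n
#marked≤length (particle ∷ f) = m≤n⇒m≤1+n (#marked≤length f)
#marked≤length (hole ∷ f)     = m≤n⇒m≤1+n (#marked≤length f)
#marked≤length (marked ∷ f)   = s≤s (#marked≤length f)

trues-expand : ∀ f → trues (expand f) ≡ trues (plain f) + #marked f
trues-expand []             = refl
trues-expand (particle ∷ f) = cong suc (trues-expand f)
trues-expand (hole ∷ f)     = trues-expand f
trues-expand (marked ∷ f)   = trans (cong suc (trues-expand f)) (sym (+-suc _ _))

decode-particles : ∀ s k f → decode s (replicate k particle ++ f) ≡ replicate k (particleCol s) ++ decode s f
decode-particles s zero    f = refl
decode-particles s (suc k) f = cong (particleCol s ∷_) (decode-particles s k f)

#marked-particles : ∀ k f → #marked (replicate k particle ++ f) ≡ #marked f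
#marked-particles zero    f = refl
#marked-particles (suc k) f = #marked-particles k f

-- Holes are numbered 1, 2, … from the left; D 0 is never looked at.
mark : (ℕ → Bool) → List Bool → List Letter
mark D []          = []
mark D (true ∷ w)  = particle ∷ mark D w
mark D (false ∷ w) = (if D 1 then marked else hole) ∷ mark (λ j → D (suc j)) w

marks : List Letter → ℕ → Bool
marks []             j             = false
marks (particle ∷ f) j             = marks f j
marks (hole ∷ f)     zero          = false
marks (hole ∷ f)     (suc zero)    = false
marks (hole ∷ f)     (suc (suc j)) = marks f (suc j)
marks (marked ∷ f)   zero          = false
marks (marked ∷ f)   (suc zero)    = true
marks (marked ∷ f)   (suc (suc j)) = marks f (suc j)

markWeight : ℕ → List Letter → ℕ
markWeight n []             = 0
markWeight n (particle ∷ f) = markWeight n f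
markWeight n (hole ∷ f)     = markWeight (suc n) f
markWeight n (marked ∷ f)   = suc n + markWeight (suc n) f

mark-cong : ∀ {D D′ : ℕ → Bool} → (∀ j → D (suc j) ≡ D′ (suc j)) → ∀ w → mark D w ≡ mark D′ w
mark-cong D≗D′ []          = refl
mark-cong D≗D′ (true ∷ w)  = cong (particle ∷_) (mark-cong D≗D′ w)
mark-cong D≗D′ (false ∷ w) = cong₂ (λ b f → (if b then marked else hole) ∷ f) (D≗D′ 0) (mark-cong (λ j → D≗D′ (suc j)) w)

plain-mark : ∀ D w → plain (mark D w) ≡ w
plain-mark D []          = refl
plain-mark D (true ∷ w)  = cong (true ∷_) (plain-mark D w)
plain-mark D (false ∷ w) with D 1
... | true  = cong (false ∷_) (plain-mark (λ j → D (suc j)) w)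
... | false = cong (false ∷_) (plain-mark (λ j → D (suc j)) w)

length-mark : ∀ D w → length (mark D w) ≡ length w
length-mark D w = trans (sym (length-map isParticle (mark D w))) (cong length (plain-mark D w))

mark-particles : ∀ D k w → mark D (replicate k true ++ w) ≡ replicate k particle ++ mark D w
mark-particles D zero    w = refl
mark-particles D (suc k) w = cong (particle ∷_) (mark-particles D k w)

marks-zero : ∀ f → marks f 0 ≡ false
marks-zero []             = refl
marks-zero (particle ∷ f) = marks-zero f
marks-zero (hole ∷ f)     = refl
marks-zero (marked ∷ f)   = refl

marks-particles : ∀ k f j → marks (replicate k particle ++ f) j ≡ marks f j
marks-particles zero    f j = refl
marks-particles (suc k) f j = marks-particles k f j

marks-mark : ∀ D w → (∀ j → falses w < j → D j ≡ false) → ∀ j → marks (mark D w) (suc j) ≡ D (suc j)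
marks-mark D []          D≡false j       = sym (D≡false (suc j) (s≤s z≤n))
marks-mark D (true ∷ w)  D≡false j       = marks-mark D w D≡false j
marks-mark D (false ∷ w) D≡false zero    with D 1
... | true  = refl
... | false = refl
marks-mark D (false ∷ w) D≡false (suc j) with D 1
... | true  = marks-mark (λ i → D (suc i)) w (λ i lt → D≡false (suc i) (s≤s lt)) j
... | false = marks-mark (λ i → D (suc i)) w (λ i lt → D≡false (suc i) (s≤s lt)) j

mark-marks : ∀ f → mark (marks f) (plain f) ≡ f
mark-marks []             = refl
mark-marks (particle ∷ f) = cong (particle ∷_) (mark-marks f)
mark-marks (hole ∷ f)     = cong (hole ∷_) (trans (mark-cong (λ _ → refl) (plain f)) (mark-marks f))
mark-marks (marked ∷ f)   = cong (marked ∷_) (trans (mark-cong (λ _ → refl) (plain f)) (mark-marks f))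

marks-beyond : ∀ f j → falses (plain f) < j → marks f j ≡ false
marks-beyond []             j             _  = refl
marks-beyond (particle ∷ f) j             lt = marks-beyond f j lt
marks-beyond (hole ∷ f)     (suc (suc j)) (s≤s lt) = marks-beyond f (suc j) lt
marks-beyond (marked ∷ f)   (suc (suc j)) (s≤s lt) = marks-beyond f (suc j) lt
marks-beyond (hole ∷ f)     (suc zero)    (s≤s ())
marks-beyond (marked ∷ f)   (suc zero)    (s≤s ())

#marked-mark : ∀ a D w → (∀ j → a < j → D j ≡ false) → #marked (mark D w) ≤ a
#marked-mark a D []          _       = z≤n
#marked-mark a D (true ∷ w)  D≡false = #marked-mark a D w D≡false
#marked-mark a D (false ∷ w) D≡false with D 1 in D1
#marked-mark zero    D (false ∷ w) D≡false | true  = contradiction (trans (sym D1) (D≡false 1 (s≤s z≤n))) λ ()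
#marked-mark (suc a) D (false ∷ w) D≡false | true  = s≤s (#marked-mark a (λ j → D (suc j)) w (λ j lt → D≡false (suc j) (s≤s lt)))
#marked-mark a       D (false ∷ w) D≡false | false = #marked-mark a (λ j → D (suc j)) w (λ j lt → D≡false (suc j) (m<n⇒m<1+n lt))

markWeight-mark : ∀ n D w → markWeight n (mark D w) ≡ sumBelow (falses w) (λ j → if D (suc j) then n + suc j else 0)
markWeight-mark n D []          = refl
markWeight-mark n D (true ∷ w)  = markWeight-mark n D w
markWeight-mark n D (false ∷ w) = begin
  markWeight n ((if D 1 then marked else hole) ∷ mark D′ w)
    ≡⟨ head-step (D 1) ⟩
  (if D 1 then suc n else 0) + markWeight (suc n) (mark D′ w)
    ≡⟨ cong₂ _+_ (cong (if D 1 then_else 0) (+-comm 1 n)) (markWeight-mark (suc n) D′ w) ⟩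
  (if D 1 then n + 1 else 0) + sumBelow (falses w) (λ j → if D′ (suc j) then suc n + suc j else 0)
    ≡⟨ cong (_+_ (if D 1 then n + 1 else 0)) (sumBelow-cong (falses w) (λ j → cong (if D′ (suc j) then_else 0) (sym (+-suc n (suc j))))) ⟩
  (if D 1 then n + 1 else 0) + sumBelow (falses w) (λ j → if D′ (suc j) then n + suc (suc j) else 0)
    ≡⟨ sumBelow-suc (falses w) (λ j → if D (suc j) then n + suc j else 0) ⟨
  sumBelow (suc (falses w)) (λ j → if D (suc j) then n + suc j else 0) ∎
  where
  open ≡-Reasoning
  D′ : ℕ → Bool
  D′ j = D (suc j)
  head-step : ∀ b → markWeight n ((if b then marked else hole) ∷ mark D′ w) ≡ (if b then suc n else 0) + markWeight (suc n) (mark D′ w)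
  head-step true  = refl
  head-step false = refl

falses-snoc : ∀ p b → falses (p ++ b ∷ []) ≡ count (not b) + falses p
falses-snoc p b = trans (falses-++ p (b ∷ [])) (trans (cong (_+_ (falses p)) (+-identityʳ (count (not b)))) (+-comm (falses p) _))

-- The x-column of the j-th hole is bubbled to the front across j holes, and there it is
-- one more particle on a negative column.
mutual
  wordEnergy-expand : ∀ f p m →
    wordEnergy (p ++ expand f) (neg (m + #marked f)) ≡ wordEnergy (p ++ plain f) (neg m) + markWeight (falses p) f
  wordEnergy-expand []             p m =
    trans (cong (λ n → wordEnergy (p ++ []) (neg n)) (+-identityʳ m)) (sym (+-identityʳ _))
  wordEnergy-expand (particle ∷ f) p m = wordEnergy-expand-snoc f p true m
  wordEnergy-expand (hole ∷ f)     p m = wordEnergy-expand-snoc f p false m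
  wordEnergy-expand (marked ∷ f)   p m = begin
    wordEnergy (p ++ false ∷ true ∷ expand f) (neg (m + suc k))
      ≡⟨ cong₂ wordEnergy (sym (++-assoc p (false ∷ []) (true ∷ expand f))) (cong neg (+-suc m k)) ⟩
    wordEnergy (p′ ++ true ∷ expand f) (neg (suc (m + k)))
      ≡⟨ wordEnergy-bubble p′ (expand f) (neg (suc (m + k))) ⟩
    wordEnergy (true ∷ p′ ++ expand f) (neg (suc (m + k))) + falses p′
      ≡⟨ cong₂ _+_ (trans (wordEnergy-particle (p′ ++ expand f) (m + k)) (cong (λ w → wordEnergy w (neg (m + k))) (++-assoc p (false ∷ []) (expand f))))
                   (falses-snoc p false) ⟩
    wordEnergy (p ++ false ∷ expand f) (neg (m + k)) + suc (falses p)
      ≡⟨ cong (_+ suc (falses p)) (wordEnergy-expand-snoc f p false m) ⟩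
    (wordEnergy (p ++ false ∷ plain f) (neg m) + markWeight (suc (falses p)) f) + suc (falses p)
      ≡⟨ +-assoc (wordEnergy (p ++ false ∷ plain f) (neg m)) _ _ ⟩
    wordEnergy (p ++ false ∷ plain f) (neg m) + (markWeight (suc (falses p)) f + suc (falses p))
      ≡⟨ cong (_+_ (wordEnergy (p ++ false ∷ plain f) (neg m))) (+-comm (markWeight (suc (falses p)) f) (suc (falses p))) ⟩
    wordEnergy (p ++ false ∷ plain f) (neg m) + (suc (falses p) + markWeight (suc (falses p)) f) ∎
    where
    open ≡-Reasoning
    k : ℕ
    k = #marked f
    p′ : List Bool
    p′ = p ++ false ∷ []

  wordEnergy-expand-snoc : ∀ f p b m →
    wordEnergy (p ++ b ∷ expand f) (neg (m + #marked f)) ≡ wordEnergy (p ++ b ∷ plain f) (neg m) + markWeight (count (not b) + falses p) f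
  wordEnergy-expand-snoc f p b m = begin
    wordEnergy (p ++ b ∷ expand f) (neg (m + #marked f))
      ≡⟨ cong (λ w → wordEnergy w (neg (m + #marked f))) (++-assoc p (b ∷ []) (expand f)) ⟨
    wordEnergy ((p ++ b ∷ []) ++ expand f) (neg (m + #marked f))
      ≡⟨ wordEnergy-expand f (p ++ b ∷ []) m ⟩
    wordEnergy ((p ++ b ∷ []) ++ plain f) (neg m) + markWeight (falses (p ++ b ∷ [])) f
      ≡⟨ cong₂ (λ w n → wordEnergy w (neg m) + markWeight n f) (++-assoc p (b ∷ []) (plain f)) (falses-snoc p b) ⟩
    wordEnergy (p ++ b ∷ plain f) (neg m) + markWeight (count (not b) + falses p) f ∎
    where open ≡-Reasoning

[+p]-[+q]≡[+r]-[+s] : ∀ p q r s → p + s ≡ r + q → + p ℤ.- + q ≡ + r ℤ.- + s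
[+p]-[+q]≡[+r]-[+s] p q r s p+s≡r+q = begin
  + p ℤ.- + q              ≡⟨ ℤ.[+m]-[+n]≡m⊖n p q ⟩
  p ℤ.⊖ q                  ≡⟨ ℤ.+-cancelˡ-⊖ s p q ⟨
  (s + p) ℤ.⊖ (s + q)      ≡⟨ cong₂ ℤ._⊖_ (trans (+-comm s p) (trans p+s≡r+q (+-comm r q))) (+-comm s q) ⟩
  (q + r) ℤ.⊖ (q + s)      ≡⟨ ℤ.+-cancelˡ-⊖ q r s ⟩
  r ℤ.⊖ s                  ≡⟨ ℤ.[+m]-[+n]≡m⊖n r s ⟨
  + r ℤ.- + s              ∎
  where open ≡-Reasoning

leftCol rightCol : Config → ℕ → Col
leftCol  χ k = col χ -[1+ k ]
rightCol χ k = col χ (+ k)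

cols : Config → ℕ → ℕ → List Col
cols χ m n = window (leftCol χ) m (rightCol χ) n

cols-cong : ∀ χ χ′ → (∀ i → col χ i ≡ col χ′ i) → ∀ m n → cols χ m n ≡ cols χ′ m n
cols-cong χ χ′ χ≗χ′ m n = cong₂ _++_ (applyDownFrom-cong (λ k → χ≗χ′ -[1+ k ]) m) (applyUpTo-cong (λ k → χ≗χ′ (+ k)) n)

LeftDefault RightDefault : Config → ℕ → Set
LeftDefault  χ m = ∀ k → m ≤ k → leftCol χ k ≡ yo
RightDefault χ n = ∀ k → n ≤ k → rightCol χ k ≡ emp

-[1+k]<-c⇒c≤k : ∀ k c → -[1+ k ] ℤ.< ℤ.- (+ c) → c ≤ k
-[1+k]<-c⇒c≤k k zero    _              = z≤n
-[1+k]<-c⇒c≤k k (suc c) (ℤ.-<- c<1+k) = c<1+k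

c≤k⇒-[1+k]<-c : ∀ k c → c ≤ k → -[1+ k ] ℤ.< ℤ.- (+ c)
c≤k⇒-[1+k]<-c k zero    _   = ℤ.-<+
c≤k⇒-[1+k]<-c k (suc c) c≤k = ℤ.-<- c≤k

+k≮-c : ∀ k c → ¬ (+ k ℤ.< ℤ.- (+ c))
+k≮-c k zero    (ℤ.+<+ ())
+k≮-c k (suc c) ()

leftDefault-cbound : ∀ χ → LeftDefault χ (cbound χ)
leftDefault-cbound χ k cb≤k = agree χ -[1+ k ] (c≤k⇒-[1+k]<-c k (cbound χ) cb≤k)

rightDefault-cbound : ∀ χ → RightDefault χ (cbound χ)
rightDefault-cbound χ k cb≤k = dirac χ (+ k) (ℤ.+≤+ cb≤k)

nonEmpty⇒leftDefault : ∀ χ m → (∀ k → m ≤ k → isEmpty (leftCol χ k) ≡ false) → LeftDefault χ m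
nonEmpty⇒leftDefault χ m nonEmpty k m≤k = down (cbound χ) k m≤k (m≤n+m (cbound χ) k)
  where
  yo-after-yo : ∀ c → Compatible yo c → isEmpty c ≡ false → c ≡ yo
  yo-after-yo yo  _ _ = refl
  yo-after-yo xo  () _
  yo-after-yo emp _ ()
  down : ∀ d k → m ≤ k → cbound χ ≤ k + d → col χ -[1+ k ] ≡ yo
  down zero    k m≤k cb≤k+0 = leftDefault-cbound χ k (≤-trans cb≤k+0 (≤-reflexive (+-identityʳ k)))
  down (suc d) k m≤k cb≤k+d+1 with cbound χ ≤? k
  ... | yes cb≤k = leftDefault-cbound χ k cb≤k
  ... | no  _    = yo-after-yo (col χ -[1+ k ])
                     (subst (λ c → Compatible c (col χ -[1+ k ]))
                            (down d (suc k) (m≤n⇒m≤1+n m≤k) (≤-trans cb≤k+d+1 (≤-reflexive (+-suc k d))))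
                            (valid χ -[1+ suc k ]))
                     (nonEmpty k m≤k)

cols-valid : ∀ χ m n → col χ -[1+ m ] ≡ yo → ValidAfter yo (cols χ m n)
cols-valid χ m n L[m]≡yo = subst (λ c → ValidAfter c (cols χ m n)) L[m]≡yo (from-left m)
  where
  rightward : ∀ (F : ℕ → Col) → (∀ j → Compatible (F j) (F (suc j))) → ∀ n → ValidAfter (F 0) (applyUpTo (λ k → F (suc k)) n)
  rightward F F~ zero    = tt
  rightward F F~ (suc n) = F~ 0 , rightward (λ k → F (suc k)) (λ j → F~ (suc j)) n
  R~ : ∀ j → Compatible (rightCol χ j) (rightCol χ (suc j))
  R~ j = subst (λ i → Compatible (rightCol χ j) (rightCol χ i)) (+-comm j 1) (valid χ (+ j))
  from-middle : ∀ n → ValidAfter (leftCol χ 0) (applyUpTo (rightCol χ) n)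
  from-middle zero    = tt
  from-middle (suc n) = valid χ -[1+ 0 ] , rightward (rightCol χ) R~ n
  from-left : ∀ m → ValidAfter (leftCol χ m) (cols χ m n)
  from-left zero    = from-middle n
  from-left (suc m) = valid χ -[1+ suc m ] , from-left m

occupied-else : ∀ c k → (if occupied c then 0 else suc k) ≡ (if isEmpty c then suc k else 0)
occupied-else emp k = refl
occupied-else xo  k = refl
occupied-else yo  k = refl

count-not-occupied : ∀ c → count (not (occupied c)) ≡ count (isEmpty c)
count-not-occupied emp = refl
count-not-occupied xo  = refl
count-not-occupied yo  = refl

energy-cols : ∀ χ m n → LeftDefault χ m → RightDefault χ n →
              energy χ ≡ wordEnergy (map occupied (cols χ m n)) (neg m)
energy-cols χ m n left right = begin
  energy χ
    ≡⟨ cong₂ _+_ (sumBelow-default (cbound χ) n (rightCol χ) emp (λ k c → if occupied c then k else 0) (λ _ → refl) (rightDefault-cbound χ) right)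
                 (sumBelow-default (cbound χ) m (leftCol χ) yo (λ k c → if isEmpty c then suc k else 0) (λ _ → refl) (leftDefault-cbound χ) left) ⟩
  sumBelow n (λ k → if occupied (rightCol χ k) then k else 0) + sumBelow m (λ k → if isEmpty (leftCol χ k) then suc k else 0)
    ≡⟨ +-comm (sumBelow n (λ k → if occupied (rightCol χ k) then k else 0)) _ ⟩
  sumBelow m (λ k → if isEmpty (leftCol χ k) then suc k else 0) + sumBelow n (λ k → if occupied (rightCol χ k) then k else 0)
    ≡⟨ cong (_+ sumBelow n (λ k → if occupied (rightCol χ k) then k else 0)) (sumBelow-cong m (λ k → sym (occupied-else (leftCol χ k) k))) ⟩
  sumBelow m (λ k → if occupied (leftCol χ k) then 0 else suc k) + sumBelow n (weightIf (λ k → occupied (rightCol χ k)))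
    ≡⟨ wordEnergy-window (λ k → occupied (leftCol χ k)) m (λ k → occupied (rightCol χ k)) n ⟨
  wordEnergy (window (λ k → occupied (leftCol χ k)) m (λ k → occupied (rightCol χ k)) n) (neg m)
    ≡⟨ cong (λ w → wordEnergy w (neg m)) (map-window occupied (leftCol χ) m (rightCol χ) n) ⟨
  wordEnergy (map occupied (cols χ m n)) (neg m) ∎
  where open ≡-Reasoning

charge-cols : ∀ χ m n → LeftDefault χ m → RightDefault χ n →
              charge χ ≡ + trues (map occupied (cols χ m n)) ℤ.- + m
charge-cols χ m n left right = begin
  charge χ
    ≡⟨ cong₂ (λ p q → + p ℤ.- + q)
         (sumBelow-default (cbound χ) n (rightCol χ) emp (λ _ c → count (occupied c)) (λ _ → refl) (rightDefault-cbound χ) right)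
         (sumBelow-default (cbound χ) m (leftCol χ) yo (λ _ c → count (isEmpty c)) (λ _ → refl) (leftDefault-cbound χ) left) ⟩
  + sumBelow n (λ k → count (occupied (rightCol χ k))) ℤ.- + sumBelow m (λ k → count (isEmpty (leftCol χ k)))
    ≡⟨ [+p]-[+q]≡[+r]-[+s] _ _ _ m (trans (trues-window (λ k → occupied (leftCol χ k)) m (λ k → occupied (rightCol χ k)) n)
         (cong₂ _+_ (cong trues (sym (map-window occupied (leftCol χ) m (rightCol χ) n))) (sumBelow-cong m (λ k → count-not-occupied (leftCol χ k))))) ⟩
  + trues (map occupied (cols χ m n)) ℤ.- + m ∎
  where open ≡-Reasoning

module _ (χ χ′ : Config) (χ≗χ′ : ∀ i → col χ i ≡ col χ′ i) where

  private
    N : ℕ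
    N = cbound χ
    left′ : LeftDefault χ′ N
    left′ k N≤k = trans (sym (χ≗χ′ -[1+ k ])) (leftDefault-cbound χ k N≤k)
    right′ : RightDefault χ′ N
    right′ k N≤k = trans (sym (χ≗χ′ (+ k))) (rightDefault-cbound χ k N≤k)
    cols≡ : cols χ N N ≡ cols χ′ N N
    cols≡ = cols-cong χ χ′ χ≗χ′ N N

  energy-cong : energy χ ≡ energy χ′
  energy-cong = trans (energy-cols χ N N (leftDefault-cbound χ) (rightDefault-cbound χ))
                      (trans (cong (λ w → wordEnergy (map occupied w) (neg N)) cols≡) (sym (energy-cols χ′ N N left′ right′)))

  charge-cong : charge χ ≡ charge χ′
  charge-cong = trans (charge-cols χ N N (leftDefault-cbound χ) (rightDefault-cbound χ))
                      (trans (cong (λ w → + trues (map occupied w) ℤ.- + N) cols≡) (sym (charge-cols χ′ N N left′ right′)))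

ValidAfter-head : ∀ c R → ValidAfter c R → Compatible c (lookupOr emp R 0)
ValidAfter-head c []      _         = Compatible-emp c
ValidAfter-head c (x ∷ R) (c~x , _) = c~x

ValidAfter-lookupOr : ∀ c R → ValidAfter c R → ∀ n → Compatible (lookupOr emp R n) (lookupOr emp R (suc n))
ValidAfter-lookupOr c []      _       n       = tt
ValidAfter-lookupOr c (x ∷ R) (_ , v) zero    = ValidAfter-head x R v
ValidAfter-lookupOr c (x ∷ R) (_ , v) (suc n) = ValidAfter-lookupOr x R v n

record ZipperValid (L R : List Col) : Set where
  field
    left-valid   : ∀ n → Compatible (lookupOr yo L (suc n)) (lookupOr yo L n)
    middle-valid : Compatible (lookupOr yo L 0) (lookupOr emp R 0)
    right-valid  : ∀ n → Compatible (lookupOr emp R n) (lookupOr emp R (suc n))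

zipperValid : ∀ L R → ValidAfter yo (reverse L ++ R) → ZipperValid L R
zipperValid []      R v = record
  { left-valid = λ _ → tt ; middle-valid = ValidAfter-head yo R v ; right-valid = ValidAfter-lookupOr yo R v }
zipperValid (x ∷ L) R v = record
  { left-valid = left ; middle-valid = right-valid 0 ; right-valid = λ n → right-valid (suc n) }
  where
  shift : reverse (x ∷ L) ++ R ≡ reverse L ++ x ∷ R
  shift = trans (cong (_++ R) (unfold-reverse x L)) (++-assoc (reverse L) (x ∷ []) R)
  open ZipperValid (zipperValid L (x ∷ R) (subst (ValidAfter yo) shift v))
  left : ∀ n → Compatible (lookupOr yo (x ∷ L) (suc n)) (lookupOr yo (x ∷ L) n)
  left zero    = middle-valid
  left (suc n) = left-valid n

zipperCol : List Col → List Col → ℤ → Col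
zipperCol L R (+ n)    = lookupOr emp R n
zipperCol L R -[1+ n ] = lookupOr yo L n

-- L lists the columns -1, -2, … and R the columns 0, 1, …
zipper : (L R : List Col) → ZipperValid L R → Config
zipper L R zv = record
  { col    = zipperCol L R
  ; valid  = valid′
  ; cbound = length L + length R
  ; agree  = agree′
  ; dirac  = dirac′
  }
  where
  open ZipperValid zv
  valid′ : ∀ i → Compatible (zipperCol L R i) (zipperCol L R (i ℤ.+ ℤ.1ℤ))
  valid′ (+ n)           = subst (λ j → Compatible (lookupOr emp R n) (lookupOr emp R j)) (+-comm 1 n) (right-valid n)
  valid′ -[1+ zero ]     = middle-valid
  valid′ -[1+ suc n ]    = left-valid n
  agree′ : ∀ i → i ℤ.< ℤ.- (+ (length L + length R)) → zipperCol L R i ≡ yo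
  agree′ (+ n)    lt = ⊥-elim (+k≮-c n _ lt)
  agree′ -[1+ n ] lt = lookupOr-beyond yo L n (≤-trans (m≤m+n _ _) (-[1+k]<-c⇒c≤k n _ lt))
  dirac′ : ∀ i → + (length L + length R) ℤ.≤ i → zipperCol L R i ≡ emp
  dirac′ (+ n) (ℤ.+≤+ ≤n) = lookupOr-beyond emp R n (≤-trans (m≤n+m _ _) ≤n)

-- c on the columns -o, -o + 1, …, with y-columns to its left and empty ones to its right.
placeAt : (o : ℕ) (c : List Col) → ValidAfter yo c → Config
placeAt o c v = zipper (reverse (take o c)) (drop o c) (zipperValid _ _ (subst (ValidAfter yo) (sym split) v))
  where
  split : reverse (reverse (take o c)) ++ drop o c ≡ c
  split = trans (cong (_++ drop o c) (reverse-involutive (take o c))) (take++drop≡id o c)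

placeAt-cong : ∀ {o o′ c c′} → o ≡ o′ → c ≡ c′ → ∀ v v′ i → col (placeAt o c v) i ≡ col (placeAt o′ c′ v′) i
placeAt-cong refl refl v v′ i = refl

placeAt-pad : ∀ k o c v v′ i → col (placeAt (k + o) (replicate k yo ++ c) v) i ≡ col (placeAt o c v′) i
placeAt-pad k o c v v′ (+ n)    = cong (λ R → lookupOr emp R n) (drop-replicate-++ k o yo c)
placeAt-pad k o c v v′ -[1+ n ] = lookupOr-reverse-take-pad yo k o c n

placeAt-leftDefault : ∀ o c v → LeftDefault (placeAt o c v) o
placeAt-leftDefault o c v k o≤k =
  lookupOr-beyond yo (reverse (take o c)) k (≤-trans (≤-reflexive (trans (length-reverse (take o c)) (length-take o c))) (≤-trans (m⊓n≤m o _) o≤k))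

placeAt-rightDefault : ∀ o c v → RightDefault (placeAt o c v) (length (drop o c))
placeAt-rightDefault o c v k = lookupOr-beyond emp (drop o c) k

cols-placeAt : ∀ o c v → o ≤ length c → cols (placeAt o c v) o (length (drop o c)) ≡ c
cols-placeAt o c v o≤ = trans (cong₂ _++_ left (applyUpTo-lookupOr emp (drop o c))) (take++drop≡id o c)
  where
  L : List Col
  L = reverse (take o c)
  left : applyDownFrom (lookupOr yo L) o ≡ take o c
  left = begin
    applyDownFrom (lookupOr yo L) o           ≡⟨ cong (applyDownFrom (lookupOr yo L)) (trans (length-reverse (take o c)) (length-take-≤ o c o≤)) ⟨
    applyDownFrom (lookupOr yo L) (length L)  ≡⟨ applyDownFrom-lookupOr yo L ⟩
    reverse L                                 ≡⟨ reverse-involutive (take o c) ⟩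
    take o c                                  ∎
    where open ≡-Reasoning

placeAt-cols : ∀ χ m n v → LeftDefault χ m → RightDefault χ n → ∀ i → col (placeAt m (cols χ m n) v) i ≡ col χ i
placeAt-cols χ m n v left right (+ k) =
  trans (cong (λ R′ → lookupOr emp R′ k) (drop-window (leftCol χ) m (rightCol χ) n)) (lookupOr-applyUpTo emp (rightCol χ) n right k)
placeAt-cols χ m n v left right -[1+ k ] =
  trans (cong (λ L′ → lookupOr yo (reverse L′) k) (take-window (leftCol χ) m (rightCol χ) n))
        (trans (cong (λ L′ → lookupOr yo L′ k) (reverse-applyDownFrom (leftCol χ) m)) (lookupOr-applyUpTo yo (leftCol χ) m left k))

energy-placeAt : ∀ o c v → o ≤ length c → energy (placeAt o c v) ≡ wordEnergy (map occupied c) (neg o)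
energy-placeAt o c v o≤ =
  trans (energy-cols (placeAt o c v) o _ (placeAt-leftDefault o c v) (placeAt-rightDefault o c v))
        (cong (λ w → wordEnergy (map occupied w) (neg o)) (cols-placeAt o c v o≤))

charge-placeAt : ∀ o c v → o ≤ length c → charge (placeAt o c v) ≡ + trues (map occupied c) ℤ.- + o
charge-placeAt o c v o≤ =
  trans (charge-cols (placeAt o c v) o _ (placeAt-leftDefault o c v) (placeAt-rightDefault o c v))
        (cong (λ w → + trues (map occupied w) ℤ.- + o) (cols-placeAt o c v o≤))

-- The correspondence inside a window

1+2*k≡1+[k+k] : ∀ k → 1 + 2 * k ≡ suc (k + k)
1+2*k≡1+[k+k] k = cong suc (cong (_+_ k) (+-identityʳ k))

oWeight phiWeight phiSWeight : Monomial → ℕ → ℕ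
oWeight    m k = omult m k * (1 + 2 * k)
phiWeight  m k = if phi m k then k else 0
phiSWeight m k = if phiS m k then suc k else 0

wWeight-split : ∀ m → wWeight m ≡ (sumBelow (bound m) (oWeight m) + sumBelow (bound m) (phiWeight m)) + sumBelow (bound m) (phiSWeight m)
wWeight-split m = trans (sumBelow-+ (bound m) _ (phiSWeight m)) (cong (_+ sumBelow (bound m) (phiSWeight m)) (sumBelow-+ (bound m) (oWeight m) (phiWeight m)))

module Window (W : ℕ) where

  digits : ℕ
  digits = W + W

  -- The Maya diagram of m on the columns -W, …, W - 1.
  fermionWord : Monomial → List Bool
  fermionWord m = window (λ k → not (phiS m k)) W (phi m) W

  parts : Monomial → ℕ → Bool
  parts m = distinctParts digits (omult m)

  letters : Monomial → List Letter
  letters m = mark (parts m) (fermionWord m)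

  -- The x-columns of the marks enlarge the negative side, which keeps the charge.
  configOf : List Letter → Config
  configOf f = placeAt (#marked f + W) (decode Y f) (decode-valid Y yo f tt)

  toConfig : Monomial → Config
  toConfig m = configOf (letters m)

  readPhi readPhiS : ℕ → List Bool → ℕ → Bool
  readPhi  o w n = lookupOr false (drop o w) n
  readPhiS o w n = not (lookupOr true (reverse (take o w)) n)

  -- As in configOf, the origin of plain f is #marked f positions earlier than that of decode Y f.
  monomialOf : List Letter → Monomial
  monomialOf f = record
    { omult     = oddParts digits (marks f)
    ; phi       = readPhi o (plain f)
    ; phiS      = readPhiS o (plain f)
    ; bound     = suc (length f)
    ; omult-fin = λ k B≤k → oddParts-vanish digits (marks f) (suc (length f))
                             (λ j B≤j → marks-beyond f j (≤-trans (s≤s falses≤) B≤j)) k (≤-trans B≤k (≤-trans (m≤m+n k k) (n≤1+n _)))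
    ; phi-fin   = λ k B≤k → lookupOr-beyond false (drop o (plain f)) k
                             (≤-trans (≤-trans (≤-reflexive (length-drop o (plain f))) (≤-trans (m∸n≤m _ o) length-plain)) (<⇒≤ B≤k))
    ; phiS-fin  = λ k B≤k → cong not (lookupOr-beyond true (reverse (take o (plain f))) k
                             (≤-trans (≤-reflexive (trans (length-reverse (take o (plain f))) (length-take o (plain f))))
                                      (≤-trans (m⊓n≤n o _) (≤-trans length-plain (<⇒≤ B≤k)))))
    }
    where
    o : ℕ
    o = W ∸ #marked f
    length-plain : length (plain f) ≤ length f
    length-plain = ≤-reflexive (length-map isParticle f)
    falses≤ : falses (plain f) ≤ length f
    falses≤ = ≤-trans (falses≤length (plain f)) length-plain

  fromConfig : Config → Monomial
  fromConfig χ = monomialOf (encode (cols χ W W))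

  record Fits (m : Monomial) : Set where
    field
      phi-fits  : ∀ n → W ≤ n → phi m n ≡ false
      phiS-fits : ∀ n → W ≤ n → phiS m n ≡ false
      parts-fit : ∀ j → falses (fermionWord m) < j → parts m j ≡ false
      glaisher  : ∀ k → oddParts digits (parts m) k ≡ omult m k

  configOf-padded : ∀ f i → col (configOf (replicate (#marked f) particle ++ f)) i ≡ col (placeAt W (decode Y f) (decode-valid Y yo f tt)) i
  configOf-padded f i = trans (placeAt-cong (cong (_+ W) (#marked-particles k f)) (decode-particles Y k f) (decode-valid Y yo _ tt) padded i)
                              (placeAt-pad k W (decode Y f) padded (decode-valid Y yo f tt) i)
    where
    k : ℕ
    k = #marked f
    padded : ValidAfter yo (replicate k yo ++ decode Y f)
    padded = subst (ValidAfter yo) (decode-particles Y k f) (decode-valid Y yo (replicate k particle ++ f) tt)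

  length-fermionWord : ∀ m → length (fermionWord m) ≡ W + W
  length-fermionWord m = length-window _ W _ W

  length-letters : ∀ m → length (letters m) ≡ W + W
  length-letters m = trans (length-mark (parts m) (fermionWord m)) (length-fermionWord m)

  toConfig-cong : ∀ {m m′} → m ≈ᴹ m′ → ∀ i → col (toConfig m) i ≡ col (toConfig m′) i
  toConfig-cong {m} {m′} (omult≗ , phi≗ , phiS≗) i = cong (λ f → col (configOf f) i) letters≡
    where
    letters≡ : letters m ≡ letters m′
    letters≡ = trans (mark-cong (λ j → distinctParts-cong digits omult≗ (suc j)) (fermionWord m))
                     (cong (mark (parts m′)) (cong₂ _++_ (applyDownFrom-cong (λ k → cong not (phiS≗ k)) W) (applyUpTo-cong phi≗ W)))

  fromConfig-cong : ∀ {χ χ′} → (∀ i → col χ i ≡ col χ′ i) → fromConfig χ ≈ᴹ fromConfig χ′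
  fromConfig-cong {χ} {χ′} χ≗χ′ = Setoid.reflexive MonomialSetoid (cong (λ c → monomialOf (encode c)) (cols-cong χ χ′ χ≗χ′ W W))

  module _ {m : Monomial} (fits : Fits m) where
    open Fits fits

    private
      B : ℕ
      B = bound m
      f : List Letter
      f = letters m
      k : ℕ
      k = #marked f

    fermionWord-energy : wordEnergy (fermionWord m) (neg W) ≡ sumBelow B (phiSWeight m) + sumBelow B (phiWeight m)
    fermionWord-energy = trans (wordEnergy-window (λ j → not (phiS m j)) W (phi m) W) (cong₂ _+_
      (trans (sumBelow-cong W (λ j → if-not (phiS m j) j))
             (sumBelow-default W B (phiS m) false (λ j b → if b then suc j else 0) (λ _ → refl) phiS-fits (phiS-fin m)))
      (sumBelow-default W B (phi m) false (λ j b → if b then j else 0) (λ _ → refl) phi-fits (phi-fin m)))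
      where
      if-not : ∀ b j → (if not b then 0 else suc j) ≡ (if b then suc j else 0)
      if-not true  j = refl
      if-not false j = refl

    markWeight-letters : markWeight 0 f ≡ sumBelow B (oWeight m)
    markWeight-letters = begin
      markWeight 0 f                                          ≡⟨ markWeight-mark 0 D (fermionWord m) ⟩
      sumBelow H (λ j → weightIf D (suc j))                   ≡⟨ cong (_+ sumBelow H (λ j → weightIf D (suc j))) (weightIf-0 D) ⟨
      weightIf D 0 + sumBelow H (λ j → weightIf D (suc j))    ≡⟨ sumBelow-suc H (weightIf D) ⟨
      sumBelow R (weightIf D)                                 ≡⟨ sumBelow-default R (R + R) D false (λ j b → if b then j else 0) (λ _ → refl) D≥R D≥R+R ⟩
      sumBelow (R + R) (weightIf D)                           ≡⟨ oddParts-weight digits R D D≥R D≥2^digits ⟨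
      sumBelow R (λ j → oddParts digits D j * suc (j + j))    ≡⟨ sumBelow-cong R (λ j → cong₂ _*_ (glaisher j) (sym (1+2*k≡1+[k+k] j))) ⟩
      sumBelow R (oWeight m)                                  ≡⟨ sumBelow-default R B (omult m) 0 (λ j o → o * (1 + 2 * j)) (λ _ → refl) omult≥R (omult-fin m) ⟩
      sumBelow B (oWeight m)                                  ∎
      where
      open ≡-Reasoning
      D : ℕ → Bool
      D = parts m
      H R : ℕ
      H = falses (fermionWord m)
      R = suc H
      D≥R : ∀ j → R ≤ j → D j ≡ false
      D≥R j R≤j = parts-fit j R≤j
      D≥R+R : ∀ j → R + R ≤ j → D j ≡ false
      D≥R+R j le = D≥R j (≤-trans (m≤m+n R R) le)
      D≥2^digits : ∀ j → 2 ^ digits ≤ j → D j ≡ false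
      D≥2^digits j le = parts-fit j (≤-trans (s≤s (≤-trans (falses≤length (fermionWord m)) (≤-reflexive (length-fermionWord m))))
                                             (≤-trans (n<2^n digits) le))
      omult≥R : ∀ j → R ≤ j → omult m j ≡ 0
      omult≥R j R≤j = trans (sym (glaisher j)) (oddParts-vanish digits D R D≥R j (≤-trans R≤j (≤-trans (m≤m+n j j) (n≤1+n _))))

    k+W≤length : k + W ≤ length (decode Y f)
    k+W≤length = begin
      k + W              ≡⟨ +-comm k W ⟩
      W + k              ≤⟨ +-monoˡ-≤ k (m≤m+n W W) ⟩
      (W + W) + k        ≡⟨ cong (_+ k) (length-letters m) ⟨
      length f + k       ≡⟨ length-decode Y f ⟨
      length (decode Y f) ∎
      where open ≤-Reasoning

    energy-toConfig : energy (toConfig m) ≡ wWeight m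
    energy-toConfig = begin
      energy (toConfig m)                                           ≡⟨ energy-placeAt (k + W) (decode Y f) (decode-valid Y yo f tt) k+W≤length ⟩
      wordEnergy (map occupied (decode Y f)) (neg (k + W))          ≡⟨ cong₂ wordEnergy (occupied-decode Y f) (cong neg (+-comm k W)) ⟩
      wordEnergy (expand f) (neg (W + k))                           ≡⟨ wordEnergy-expand f [] W ⟩
      wordEnergy (plain f) (neg W) + markWeight 0 f                 ≡⟨ cong (λ w → wordEnergy w (neg W) + markWeight 0 f) (plain-mark (parts m) (fermionWord m)) ⟩
      wordEnergy (fermionWord m) (neg W) + markWeight 0 f           ≡⟨ cong₂ _+_ fermionWord-energy markWeight-letters ⟩
      (sumBelow B (phiSWeight m) + sumBelow B (phiWeight m)) + sumBelow B (oWeight m)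
        ≡⟨ solve 3 (λ x y z → (x :+ y) :+ z := (z :+ y) :+ x) refl (sumBelow B (phiSWeight m)) (sumBelow B (phiWeight m)) (sumBelow B (oWeight m)) ⟩
      (sumBelow B (oWeight m) + sumBelow B (phiWeight m)) + sumBelow B (phiSWeight m)
        ≡⟨ wWeight-split m ⟨
      wWeight m                                                     ∎
      where open ≡-Reasoning

    charge-toConfig : charge (toConfig m) ≡ sWeight m
    charge-toConfig = begin
      charge (toConfig m)                                           ≡⟨ charge-placeAt (k + W) (decode Y f) (decode-valid Y yo f tt) k+W≤length ⟩
      + trues (map occupied (decode Y f)) ℤ.- + (k + W)             ≡⟨ cong (λ t → + t ℤ.- + (k + W)) trues-decode ⟩
      + (T + k) ℤ.- + (k + W)                                       ≡⟨ [+p]-[+q]≡[+r]-[+s] (T + k) (k + W) (Cph W) (Cps W) balance ⟩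
      + Cph W ℤ.- + Cps W                                           ≡⟨ cong₂ (λ p q → + p ℤ.- + q)
                                                                        (sumBelow-default W B (phi m) false (λ _ b → count b) (λ _ → refl) phi-fits (phi-fin m))
                                                                        (sumBelow-default W B (phiS m) false (λ _ b → count b) (λ _ → refl) phiS-fits (phiS-fin m)) ⟩
      sWeight m                                                     ∎
      where
      open ≡-Reasoning
      T : ℕ
      T = trues (fermionWord m)
      Cph Cps : ℕ → ℕ
      Cph n = sumBelow n (λ j → count (phi m j))
      Cps n = sumBelow n (λ j → count (phiS m j))
      trues-decode : trues (map occupied (decode Y f)) ≡ T + k
      trues-decode = trans (cong trues (occupied-decode Y f))
                           (trans (trues-expand f) (cong (λ w → trues w + k) (plain-mark (parts m) (fermionWord m))))
      fermion-balance : Cph W + W ≡ T + Cps W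
      fermion-balance = trans (trues-window (λ j → not (phiS m j)) W (phi m) W)
                              (cong (_+_ T) (sumBelow-cong W (λ j → cong count (not-involutive (phiS m j)))))
      balance : (T + k) + Cps W ≡ Cph W + (k + W)
      balance = begin
        (T + k) + Cps W     ≡⟨ solve 3 (λ t x c → (t :+ x) :+ c := (t :+ c) :+ x) refl T k (Cps W) ⟩
        (T + Cps W) + k     ≡⟨ cong (_+ k) fermion-balance ⟨
        (Cph W + W) + k     ≡⟨ solve 3 (λ p w x → (p :+ w) :+ x := p :+ (x :+ w)) refl (Cph W) W k ⟩
        Cph W + (k + W)     ∎

  readPhi-pad : ∀ k o w n → readPhi (k + o) (replicate k true ++ w) n ≡ readPhi o w n
  readPhi-pad k o w n = cong (λ w′ → lookupOr false w′ n) (drop-replicate-++ k o true w)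

  readPhiS-pad : ∀ k o w n → readPhiS (k + o) (replicate k true ++ w) n ≡ readPhiS o w n
  readPhiS-pad k o w n = cong not (lookupOr-reverse-take-pad true k o w n)

  fermionWord-read : ∀ o w → o ≤ W → length w ≡ o + W →
                     window (λ n → not (readPhiS o w n)) W (readPhi o w) W ≡ replicate (W ∸ o) true ++ w
  fermionWord-read o w o≤W length-w = begin
    applyDownFrom (λ n → not (readPhiS o w n)) W ++ applyUpTo (readPhi o w) W
      ≡⟨ cong₂ _++_ (applyDownFrom-cong (λ n → not-involutive (lookupOr true L n)) W) (cong (applyUpTo (readPhi o w)) (sym length-drop-o)) ⟩
    applyDownFrom (lookupOr true L) W ++ applyUpTo (lookupOr false (drop o w)) (length (drop o w))
      ≡⟨ cong₂ _++_ (cong (applyDownFrom (lookupOr true L)) W≡) (applyUpTo-lookupOr false (drop o w)) ⟩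
    applyDownFrom (lookupOr true L) ((W ∸ o) + length L) ++ drop o w
      ≡⟨ cong (_++ drop o w) (applyDownFrom-lookupOr-pad true L (W ∸ o)) ⟩
    (replicate (W ∸ o) true ++ reverse L) ++ drop o w
      ≡⟨ ++-assoc (replicate (W ∸ o) true) (reverse L) (drop o w) ⟩
    replicate (W ∸ o) true ++ (reverse L ++ drop o w)
      ≡⟨ cong (λ u → replicate (W ∸ o) true ++ (u ++ drop o w)) (reverse-involutive (take o w)) ⟩
    replicate (W ∸ o) true ++ (take o w ++ drop o w)
      ≡⟨ cong (replicate (W ∸ o) true ++_) (take++drop≡id o w) ⟩
    replicate (W ∸ o) true ++ w ∎
    where
    open ≡-Reasoning
    L : List Bool
    L = reverse (take o w)
    length-drop-o : length (drop o w) ≡ W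
    length-drop-o = trans (length-drop o w) (trans (cong (_∸ o) length-w) (m+n∸m≡n o W))
    W≡ : W ≡ (W ∸ o) + length L
    W≡ = sym (trans (cong (_+_ (W ∸ o)) (trans (length-reverse (take o w)) (length-take-≤ o w (≤-trans (m≤m+n o W) (≤-reflexive (sym length-w))))))
                    (m∸n+n≡m o≤W))

  module _ {m : Monomial} (fits : Fits m) where
    open Fits fits

    readPhi-fermionWord : ∀ n → readPhi W (fermionWord m) n ≡ phi m n
    readPhi-fermionWord n = trans (cong (λ w → lookupOr false w n) (drop-window _ W (phi m) W))
                                  (lookupOr-applyUpTo false (phi m) W phi-fits n)

    readPhiS-fermionWord : ∀ n → readPhiS W (fermionWord m) n ≡ phiS m n
    readPhiS-fermionWord n = begin
      not (lookupOr true (reverse (take W (fermionWord m))) n)   ≡⟨ cong (λ w → not (lookupOr true (reverse w) n)) (take-window L W (phi m) W) ⟩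
      not (lookupOr true (reverse (applyDownFrom L W)) n)        ≡⟨ cong (λ w → not (lookupOr true w n)) (reverse-applyDownFrom L W) ⟩
      not (lookupOr true (applyUpTo L W) n)                      ≡⟨ cong not (lookupOr-applyUpTo true L W (λ j W≤j → cong not (phiS-fits j W≤j)) n) ⟩
      not (not (phiS m n))                                       ≡⟨ not-involutive (phiS m n) ⟩
      phiS m n                                                   ∎
      where
      open ≡-Reasoning
      L : ℕ → Bool
      L j = not (phiS m j)

    marks-letters : ∀ j → marks (letters m) j ≡ parts m j
    marks-letters zero    = trans (marks-zero (letters m)) (sym (distinctParts-zero digits (omult m)))
    marks-letters (suc j) = marks-mark (parts m) (fermionWord m) parts-fit j

    -- The marks are balanced by leading particles, which decode to default y-columns.
    module _ (f₀ : List Letter) (letters≡ : letters m ≡ replicate (#marked f₀) particle ++ f₀) where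

      private
        k : ℕ
        k = #marked f₀
        c₀ : List Col
        c₀ = decode Y f₀
        valid₀ : ValidAfter yo c₀
        valid₀ = decode-valid Y yo f₀ tt
        length-f₀ : k + length f₀ ≡ W + W
        length-f₀ = trans (cong (_+ length f₀) (sym (length-replicate k)))
                          (trans (sym (length-++ (replicate k particle))) (trans (cong length (sym letters≡)) (length-letters m)))
        k≤W : k ≤ W
        k≤W = m+m≤n+n⇒m≤n (≤-trans (+-monoʳ-≤ k (#marked≤length f₀)) (≤-reflexive length-f₀))
        length-c₀ : length c₀ ≡ W + W
        length-c₀ = trans (length-decode Y f₀) (trans (+-comm (length f₀) k) length-f₀)
        toConfig≗placeAt : ∀ i → col (toConfig m) i ≡ col (placeAt W c₀ valid₀) i
        toConfig≗placeAt i = trans (cong (λ f → col (configOf f) i) letters≡) (configOf-padded f₀ i)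
        cols-toConfig : cols (toConfig m) W W ≡ c₀
        cols-toConfig = begin
          cols (toConfig m) W W                                      ≡⟨ cols-cong (toConfig m) (placeAt W c₀ valid₀) toConfig≗placeAt W W ⟩
          cols (placeAt W c₀ valid₀) W W                             ≡⟨ cong (cols (placeAt W c₀ valid₀) W) length-drop-W ⟨
          cols (placeAt W c₀ valid₀) W (length (drop W c₀))          ≡⟨ cols-placeAt W c₀ valid₀ (≤-trans (m≤m+n W W) (≤-reflexive (sym length-c₀))) ⟩
          c₀                                                         ∎
          where
          open ≡-Reasoning
          length-drop-W : length (drop W c₀) ≡ W
          length-drop-W = trans (length-drop W c₀) (trans (cong (_∸ W) length-c₀) (m+n∸m≡n W W))
        fermionWord≡ : fermionWord m ≡ replicate k true ++ plain f₀
        fermionWord≡ = begin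
          fermionWord m                                     ≡⟨ plain-mark (parts m) (fermionWord m) ⟨
          plain (letters m)                                 ≡⟨ cong plain letters≡ ⟩
          plain (replicate k particle ++ f₀)                ≡⟨ map-++ isParticle (replicate k particle) f₀ ⟩
          map isParticle (replicate k particle) ++ plain f₀ ≡⟨ cong (_++ plain f₀) (map-replicate isParticle k particle) ⟩
          replicate k true ++ plain f₀                      ∎
          where open ≡-Reasoning
        W≡ : k + (W ∸ k) ≡ W
        W≡ = m+[n∸m]≡n k≤W
        monomialOf≈ : monomialOf f₀ ≈ᴹ m
        monomialOf≈ = (λ j → trans (oddParts-cong digits marks≗ j) (glaisher j))
                    , (λ n → trans (sym (readPhi-pad k (W ∸ k) (plain f₀) n))
                                   (trans (cong₂ (λ o w → readPhi o w n) W≡ (sym fermionWord≡)) (readPhi-fermionWord n)))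
                    , (λ n → trans (sym (readPhiS-pad k (W ∸ k) (plain f₀) n))
                                   (trans (cong₂ (λ o w → readPhiS o w n) W≡ (sym fermionWord≡)) (readPhiS-fermionWord n)))
          where
          marks≗ : ∀ j → marks f₀ j ≡ parts m j
          marks≗ j = trans (sym (marks-particles k f₀ j)) (trans (cong (λ f → marks f j) (sym letters≡)) (marks-letters j))

      fromConfig-toConfig : fromConfig (toConfig m) ≈ᴹ m
      fromConfig-toConfig = subst (_≈ᴹ m) (cong monomialOf (sym (trans (cong encode cols-toConfig) (encode-decode Y f₀)))) monomialOf≈

  module _ (χ : Config) (left : LeftDefault χ W) (right : RightDefault χ W) where

    private
      c : List Col
      c = cols χ W W
      f : List Letter
      f = encode c
      k o : ℕ
      k = #marked f
      o = W ∸ k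
      c-valid : ValidAfter yo c
      c-valid = cols-valid χ W W (left W ≤-refl)
      decode-f : decode Y f ≡ c
      decode-f = decode-encode Y c c-valid
      length-f : length f + k ≡ W + W
      length-f = trans (sym (length-decode Y f)) (trans (cong length decode-f) (length-window _ W _ W))
      k≤W : k ≤ W
      k≤W = m+m≤n+n⇒m≤n (≤-trans (+-monoˡ-≤ k (#marked≤length f)) (≤-reflexive length-f))
      length-plain : length (plain f) ≡ o + W
      length-plain = +-cancelʳ-≡ k _ _ (begin
        length (plain f) + k   ≡⟨ cong (_+ k) (length-map isParticle f) ⟩
        length f + k           ≡⟨ length-f ⟩
        W + W                  ≡⟨ cong (_+ W) (m∸n+n≡m k≤W) ⟨
        (o + k) + W            ≡⟨ solve 3 (λ x y z → (x :+ y) :+ z := (x :+ z) :+ y) refl o k W ⟩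
        (o + W) + k            ∎)
        where open ≡-Reasoning
      m′ : Monomial
      m′ = fromConfig χ
      fermionWord≡ : fermionWord m′ ≡ replicate k true ++ plain f
      fermionWord≡ = trans (fermionWord-read o (plain f) (m∸n≤m W k) length-plain)
                           (cong (λ j → replicate j true ++ plain f) (m∸[m∸n]≡n k≤W))
      parts≗marks : ∀ j → parts m′ j ≡ marks f j
      parts≗marks = distinctParts-oddParts digits (marks f) (marks-zero f)
        (λ j 2^digits≤j → marks-beyond f j (≤-trans (s≤s falses≤digits) (≤-trans (n<2^n digits) 2^digits≤j)))
        where
        falses≤digits : falses (plain f) ≤ digits
        falses≤digits = ≤-trans (falses≤length (plain f)) (≤-trans (≤-reflexive length-plain) (+-monoˡ-≤ W (m∸n≤m W k)))
      letters≡ : letters m′ ≡ replicate k particle ++ f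
      letters≡ = begin
        mark (parts m′) (fermionWord m′)                   ≡⟨ cong (mark (parts m′)) fermionWord≡ ⟩
        mark (parts m′) (replicate k true ++ plain f)      ≡⟨ mark-particles (parts m′) k (plain f) ⟩
        replicate k particle ++ mark (parts m′) (plain f)  ≡⟨ cong (_++_ (replicate k particle)) (mark-cong (λ j → parts≗marks (suc j)) (plain f)) ⟩
        replicate k particle ++ mark (marks f) (plain f)   ≡⟨ cong (_++_ (replicate k particle)) (mark-marks f) ⟩
        replicate k particle ++ f                          ∎
        where open ≡-Reasoning

    toConfig-fromConfig : ∀ i → col (toConfig (fromConfig χ)) i ≡ col χ i
    toConfig-fromConfig i = begin
      col (configOf (letters m′)) i                         ≡⟨ cong (λ f′ → col (configOf f′) i) letters≡ ⟩
      col (configOf (replicate k particle ++ f)) i          ≡⟨ configOf-padded f i ⟩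
      col (placeAt W (decode Y f) (decode-valid Y yo f tt)) i ≡⟨ placeAt-cong {W} refl decode-f (decode-valid Y yo f tt) c-valid i ⟩
      col (placeAt W c c-valid) i                           ≡⟨ placeAt-cols χ W W c-valid left right i ⟩
      col χ i                                               ∎
      where open ≡-Reasoning

    fromConfig-fits : Fits (fromConfig χ)
    fromConfig-fits = record
      { phi-fits  = λ n W≤n → lookupOr-beyond false (drop o (plain f)) n
                      (≤-trans (≤-reflexive (trans (length-drop o (plain f)) (trans (cong (_∸ o) length-plain) (m+n∸m≡n o W)))) W≤n)
      ; phiS-fits = λ n W≤n → cong not (lookupOr-beyond true (reverse (take o (plain f))) n
                      (≤-trans (≤-reflexive (trans (length-reverse (take o (plain f))) (length-take o (plain f))))
                               (≤-trans (m⊓n≤m o _) (≤-trans (m∸n≤m W k) W≤n))))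
      ; parts-fit = λ j lt → trans (parts≗marks j)
                      (marks-beyond f j (subst (_< j) (trans (cong falses fermionWord≡) (falses-replicate-true k (plain f))) lt))
      ; glaisher  = oddParts-cong digits parts≗marks
      }

    wWeight-fromConfig : wWeight (fromConfig χ) ≡ energy χ
    wWeight-fromConfig = trans (sym (energy-toConfig fromConfig-fits)) (energy-cong (toConfig (fromConfig χ)) χ toConfig-fromConfig)

    sWeight-fromConfig : sWeight (fromConfig χ) ≡ charge χ
    sWeight-fromConfig = trans (sym (charge-toConfig fromConfig-fits)) (charge-cong (toConfig (fromConfig χ)) χ toConfig-fromConfig)

-- Monomials and configurations of weight a

if-bound : ∀ {b : Bool} {x a : ℕ} → (if b then x else 0) ≤ a → a < x → b ≡ false
if-bound {false} _    _   = refl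
if-bound {true}  x≤a a<x = ⊥-elim (<⇒≱ a<x x≤a)

occupied-false : ∀ {c} → occupied c ≡ false → c ≡ emp
occupied-false {emp} _ = refl

-- W = (a + 1) + a: the a + 1 leftmost columns of the window hold particles, enough for the at most a marks.
module Bounded (a : ℕ) where

  open Window (suc (a + a)) public

  W : ℕ
  W = suc (a + a)

  a<W : a < W
  a<W = s≤s (m≤m+n a a)

  module _ (m : Monomial) (wm : wWeight m ≡ a) where

    private
      weight≤a : ∀ k → oWeight m k + phiWeight m k + phiSWeight m k ≤ a
      weight≤a k = ≤-trans (term≤sumBelow′ (bound m) _ k beyond) (≤-reflexive wm)
        where
        beyond : bound m ≤ k → oWeight m k + phiWeight m k + phiSWeight m k ≡ 0
        beyond B≤k rewrite omult-fin m k B≤k | phi-fin m k B≤k | phiS-fin m k B≤k = refl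

      phi-bound : ∀ n → a < n → phi m n ≡ false
      phi-bound n = if-bound (≤-trans (≤-trans (m≤n+m _ (oWeight m n)) (m≤m+n _ (phiSWeight m n))) (weight≤a n))

      phiS-bound : ∀ n → a ≤ n → phiS m n ≡ false
      phiS-bound n a≤n = if-bound (≤-trans (m≤n+m _ _) (weight≤a n)) (s≤s a≤n)

      oWeight≤a : ∀ k → omult m k * suc (k + k) ≤ a
      oWeight≤a k = ≤-trans (≤-reflexive (cong (omult m k *_) (sym (1+2*k≡1+[k+k] k))))
                            (≤-trans (≤-trans (m≤m+n _ _) (m≤m+n _ _)) (weight≤a k))

      parts-bound : ∀ n → a < n → parts m n ≡ false
      parts-bound n a<n with parts m n in eq
      ... | false = refl
      ... | true with distinctParts-bound digits (omult m) n eq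
      ...   | j , n≤ = ⊥-elim (<⇒≱ a<n (≤-trans n≤ (oWeight≤a j)))

      holes : a ≤ falses (fermionWord m)
      holes = begin
        a                                                        ≡⟨ falses-replicate a ⟨
        falses (replicate a false)                               ≤⟨ m≤n+m _ _ ⟩
        falses (applyUpTo (phi m) (suc a)) + falses (replicate a false)
                                                                 ≡⟨ falses-++ (applyUpTo (phi m) (suc a)) _ ⟨
        falses (applyUpTo (phi m) (suc a) ++ replicate a false)  ≡⟨ cong (λ w → falses (applyUpTo (phi m) (suc a) ++ w))
                                                                      (applyUpTo-const false _ (λ k → phi-bound (suc a + k) (s≤s (m≤m+n a k))) a) ⟨
        falses (applyUpTo (phi m) (suc a) ++ applyUpTo (λ k → phi m (suc a + k)) a)
                                                                 ≡⟨ cong falses (applyUpTo-+ (phi m) (suc a) a) ⟨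
        falses (applyUpTo (phi m) W)                             ≤⟨ m≤n+m _ (falses (applyDownFrom (λ k → not (phiS m k)) W)) ⟩
        falses (applyDownFrom (λ k → not (phiS m k)) W) + falses (applyUpTo (phi m) W)
                                                                 ≡⟨ falses-++ (applyDownFrom (λ k → not (phiS m k)) W) _ ⟨
        falses (fermionWord m)                                   ∎
        where open ≤-Reasoning

    weight⇒fits : Fits m
    weight⇒fits = record
      { phi-fits  = λ n W≤n → phi-bound n (≤-trans a<W W≤n)
      ; phiS-fits = λ n W≤n → phiS-bound n (≤-trans (<⇒≤ a<W) W≤n)
      ; parts-fit = λ j lt → parts-bound j (≤-trans (s≤s holes) lt)
      ; glaisher  = λ k → oddParts-distinctParts digits (omult m) k
                            (≤-trans (s≤s (≤-trans (m≤m*n (omult m k) (suc (k + k))) (oWeight≤a k)))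
                                     (≤-trans a<W (≤-trans (m≤m+n W W) (<⇒≤ (n<2^n digits)))))
      }

    weight⇒leadingParticles : Σ (List Letter) λ f₀ → letters m ≡ replicate (#marked f₀) particle ++ f₀
    weight⇒leadingParticles = f₀ , (begin
      letters m                                                  ≡⟨ cong (mark (parts m)) fermionWord≡ ⟩
      mark (parts m) (replicate (suc a) true ++ r)               ≡⟨ mark-particles (parts m) (suc a) r ⟩
      replicate (suc a) particle ++ mark (parts m) r             ≡⟨ cong (λ j → replicate j particle ++ mark (parts m) r) (m+[n∸m]≡n k≤1+a) ⟨
      replicate (k + (suc a ∸ k)) particle ++ mark (parts m) r   ≡⟨ cong (_++ mark (parts m) r) (replicate-+ k (suc a ∸ k) particle) ⟩
      (replicate k particle ++ replicate (suc a ∸ k) particle) ++ mark (parts m) r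
                                                                 ≡⟨ ++-assoc (replicate k particle) _ _ ⟩
      replicate k particle ++ f₀                                 ≡⟨ cong (λ j → replicate j particle ++ f₀) (#marked-particles (suc a ∸ k) (mark (parts m) r)) ⟨
      replicate (#marked f₀) particle ++ f₀                      ∎)
      where
      open ≡-Reasoning
      L : ℕ → Bool
      L k = not (phiS m k)
      r : List Bool
      r = applyDownFrom L a ++ applyUpTo (phi m) W
      fermionWord≡ : fermionWord m ≡ replicate (suc a) true ++ r
      fermionWord≡ = trans (cong (_++ applyUpTo (phi m) W) (applyDownFrom-+ true L a (λ n a≤n → cong not (phiS-bound n a≤n)) (suc a)))
                           (++-assoc (replicate (suc a) true) (applyDownFrom L a) (applyUpTo (phi m) W))
      k : ℕ
      k = #marked (mark (parts m) r)
      k≤1+a : k ≤ suc a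
      k≤1+a = m≤n⇒m≤1+n (#marked-mark a (parts m) r parts-bound)
      f₀ : List Letter
      f₀ = replicate (suc a ∸ k) particle ++ mark (parts m) r

  module _ (χ : Config) (eχ : energy χ ≡ a) where

    private
      rightEnergy≤a : ∀ n → (if occupied (rightCol χ n) then n else 0) ≤ a
      rightEnergy≤a n = ≤-trans (term≤sumBelow′ (cbound χ) _ n (λ cb≤n → cong (λ c → if occupied c then n else 0) (rightDefault-cbound χ n cb≤n)))
                                (≤-trans (m≤m+n _ _) (≤-reflexive eχ))
      leftEnergy≤a : ∀ n → (if isEmpty (leftCol χ n) then suc n else 0) ≤ a
      leftEnergy≤a n = ≤-trans (term≤sumBelow′ (cbound χ) _ n (λ cb≤n → cong (λ c → if isEmpty c then suc n else 0) (leftDefault-cbound χ n cb≤n)))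
                               (≤-trans (m≤n+m _ _) (≤-reflexive eχ))

    energy⇒rightDefault : RightDefault χ W
    energy⇒rightDefault n W≤n = occupied-false (if-bound (rightEnergy≤a n) (≤-trans a<W W≤n))

    energy⇒leftDefault : LeftDefault χ W
    energy⇒leftDefault = nonEmpty⇒leftDefault χ W (λ k W≤k → if-bound (leftEnergy≤a k) (s≤s (≤-trans (<⇒≤ a<W) W≤k)))

proposition2 : (a : ℕ) (b : ℤ) → Inverse (EigenBasis a b) (ConfigsOf a b)
proposition2 a b = record
  { to        = λ (m , wm , sm) → toConfig m , trans (energy-toConfig (weight⇒fits m wm)) wm
                                             , trans (charge-toConfig (weight⇒fits m wm)) sm
  ; from      = λ (χ , eχ , cχ) → fromConfig χ , trans (wWeight-fromConfig χ (left χ eχ) (right χ eχ)) eχ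
                                               , trans (sWeight-fromConfig χ (left χ eχ) (right χ eχ)) cχ
  ; to-cong   = λ {(m , _)} {(m′ , _)} → toConfig-cong {m} {m′}
  ; from-cong = λ {(χ , _)} {(χ′ , _)} → fromConfig-cong {χ} {χ′}
  ; inverse   = (λ {(χ , eχ , _)} {(m , _)} m≈ i →
                   trans (toConfig-cong {m} {fromConfig χ} m≈ i) (toConfig-fromConfig χ (left χ eχ) (right χ eχ) i))
              , (λ {(m , wm , _)} {(χ , _)} χ≈ → let (f₀ , letters≡) = weight⇒leadingParticles m wm in
                   Setoid.trans MonomialSetoid {fromConfig χ} {fromConfig (toConfig m)} {m}
                     (fromConfig-cong {χ} {toConfig m} χ≈) (fromConfig-toConfig (weight⇒fits m wm) f₀ letters≡))
  }
  where
  open Bounded a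
  left : ∀ χ → energy χ ≡ a → LeftDefault χ W
  left = energy⇒leftDefault
  right : ∀ χ → energy χ ≡ a → RightDefault χ W
  right = energy⇒rightDefault
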